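{- Let $n\ge2$ and let $\mathcal{L}_n$ be the graph whose vertices are the planar layouts of irreducible planar tanglegrams of size $n$, two layouts being adjacent if one is obtained from the other by a rotation (as defined in the context). Then $\mathcal{L}_n$ is isomorphic to the flip graph $\mathcal{D}_{n+1}$ on ordered pairs of disjoint triangulations of a convex $(n+1)$-gon.
   Context: Tanglegrams: a tanglegram $(L,R,\sigma)$ is an ordered pair of rooted binary trees (each vertex has $0$ or $2$ children) with the same number $n$ of leaves (the size) and a perfect matching $\sigma$ between their leaves. A planar layout draws $L$ left of $x=0$ with leaves on $x=0$, $R$ right of $x=1$ with leaves on $x=1$, and matching edges as noncrossing straight segments; it is determined by the pair $(P_1,P_2)$ of plane binary trees (trees with left/right order of children) obtained, where the $i$-th leaf from the top of $P_1$ is matched with the $i$-th leaf from the top of $P_2$. A proper subtanglegram of such a pair is a pair of internal non-root vertices $u\in P_1$, $v\in P_2$ whose leaf descendants are matched exactly to each other; the tanglegram is irreducible if there is none. Rotation in a plane binary tree: let $v$ be an internal non-root vertex with parent $u$. If $v$ is the left child of $u$, with $v$ having children subtrees $A$ (left), $B$ (right) and $u$ having right subtree $C$, the rotation at $v$ puts $v$ in the place of $u$, with left subtree $A$ and right child $u$, where $u$ now has left subtree $B$ and right subtree $C$; the case where $v$ is a right child is the mirror image. Rotation of a planar layout $(P_1,P_2)$ of an irreducible planar tanglegram at an internal non-root vertex $w\in V(P_i)$: (a) rotate at $w$ in $P_i$, obtaining $P_i'$; (b) if the resulting pair (with $P_i'$ in place of $P_i$) contains a proper subtanglegram, rooted at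 $w_1\in V(P_i')$ and $w_2\in V(P_j)$ with $j\ne i$, then additionally rotate at $w_2$ in $P_j$. Triangulations: a triangulation of a convex polygon is a maximal set of noncrossing diagonals; two are disjoint if they share no diagonal. Flipping a diagonal $(a,b)$ of a triangulation replaces it by the other diagonal $(a',b')$ of the quadrilateral $(a,a',b,b')$ formed on deleting it. For an ordered pair $(T_1,T_2)$ of disjoint triangulations and $(a,b)\in T_i$, the flip at $(a,b)_i$ flips $(a,b)$ in $T_i$ and, if the new diagonal lies in $T_j$ ($j\neq i$), also flips it in $T_j$. $\mathcal{D}_{m}$ is the graph on ordered pairs of disjoint triangulations of the $m$-gon with adjacency given by such flips. -}

module Defs where

open import Data.Nat using (ℕ; zero; suc; _+_; _≤_; _<_; _<ᵇ_)
open import Data.Bool using (Bool; true; false)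
open import Data.List using (List; []; _∷_; _++_; map; upTo)
open import Data.Maybe using (Maybe; just; nothing)
open import Data.Product using (Σ; ∃; ∃-syntax; _×_; _,_; proj₁; proj₂)
open import Data.Sum using (_⊎_; inj₁; inj₂)
open import Data.Fin as F using (Fin; toℕ)
open import Data.Vec using (Vec; lookup; _[_]%=_; _[_]≔_)
open import Relation.Nullary using (¬_)
open import Data.Empty using (⊥)
open import Relation.Binary.PropositionalEquality using (_≡_)
open import Function.Bundles using (_⇔_)

-- Plane (full) binary trees: every vertex has 0 or 2 (ordered) children.
-- "left" child = upper child in the layout (leaves are numbered from the
-- top, i.e. from left to right in the plane tree).

data PTree : Set where
  leaf : PTree
  node : PTree → PTree → PTree

leaves : PTree → ℕ
leaves leaf       = 1
leaves (node l r) = leaves l + leaves r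

data Dir : Set where
  L R : Dir

Path : Set
Path = List Dir

subtreeAt : PTree → Path → Maybe PTree
subtreeAt t          []      = just t
subtreeAt leaf       (_ ∷ _) = nothing
subtreeAt (node l r) (L ∷ p) = subtreeAt l p
subtreeAt (node l r) (R ∷ p) = subtreeAt r p

InternalNonRoot : PTree → Path → Set
InternalNonRoot t []      = ⊥
InternalNonRoot t (d ∷ p) = ∃[ a ] ∃[ b ] (subtreeAt t (d ∷ p) ≡ just (node a b))

leafIdx : ℕ → PTree → List ℕ
leafIdx k leaf       = k ∷ []
leafIdx k (node l r) = leafIdx k l ++ leafIdx (k + leaves l) r

descLeaves : ℕ → PTree → Path → Maybe (List ℕ)
descLeaves k t          []      = just (leafIdx k t)
descLeaves k leaf       (_ ∷ _) = nothing
descLeaves k (node l r) (L ∷ p) = descLeaves k l p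
descLeaves k (node l r) (R ∷ p) = descLeaves (k + leaves l) r p

-- Rotation at the vertex w (w internal, non-root; junk otherwise).
-- The last step of the path tells whether w is a left or right child.
rotate : Path → PTree → PTree
rotate []            t                   = t
rotate (L ∷ [])      (node (node A B) C) = node A (node B C)
rotate (R ∷ [])      (node A (node B C)) = node (node A B) C
rotate (L ∷ d ∷ p)   (node l r)          = node (rotate (d ∷ p) l) r
rotate (R ∷ d ∷ p)   (node l r)          = node l (rotate (d ∷ p) r)
rotate (_ ∷ _)       t                   = t

-- A planar layout (P₁ , P₂): the i-th leaf from the top of P₁ is matched
-- with the i-th leaf from the top of P₂.
Pair : Set
Pair = PTree × PTree

-- proper subtanglegram of (A , B) rooted at u ∈ A, v ∈ B: internal
-- non-root vertices whose leaf descendants are matched exactly to each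
-- other (the matching being i ↦ i on leaf positions).
ProperSub : PTree → PTree → Path → Path → Set
ProperSub A B u v =
  InternalNonRoot A u × InternalNonRoot B v ×
  ∃[ xs ] (descLeaves 0 A u ≡ just xs × descLeaves 0 B v ≡ just xs)

Irreducible : Pair → Set
Irreducible (P₁ , P₂) = ¬ (∃[ u ] ∃[ v ] ProperSub P₁ P₂ u v)

Layout : ℕ → Set
Layout n = Σ Pair λ P → leaves (proj₁ P) ≡ n × leaves (proj₂ P) ≡ n × Irreducible P

RotStep : Pair → Pair → Set
RotStep (P₁ , P₂) Q =
    (∃[ w ] (InternalNonRoot P₁ w ×
      let P₁' = rotate w P₁ in
        ((¬ (∃[ w₁ ] ∃[ w₂ ] ProperSub P₁' P₂ w₁ w₂)) × Q ≡ (P₁' , P₂))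
      ⊎ (∃[ w₁ ] ∃[ w₂ ] (ProperSub P₁' P₂ w₁ w₂ × Q ≡ (P₁' , rotate w₂ P₂)))))
  ⊎ (∃[ w ] (InternalNonRoot P₂ w ×
      let P₂' = rotate w P₂ in
        ((¬ (∃[ w₁ ] ∃[ w₂ ] ProperSub P₂' P₁ w₁ w₂)) × Q ≡ (P₁ , P₂'))
      ⊎ (∃[ w₁ ] ∃[ w₂ ] (ProperSub P₂' P₁ w₁ w₂ × Q ≡ (rotate w₂ P₁ , P₂')))))

LAdj : ∀ {n} → Layout n → Layout n → Set
LAdj x y = RotStep (proj₁ x) (proj₁ y) ⊎ RotStep (proj₁ y) (proj₁ x)

-- Triangulations of the convex m-gon with vertices 0,1,…,m-1 (in cyclic
-- order).  A set of diagonals is stored canonically as a Boolean matrix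
-- S with S[a][b] = true iff the diagonal {a,b} with a < b belongs to it.

DSet : ℕ → Set
DSet m = Vec (Vec Bool m) m

_∈D_ : ∀ {m} → Fin m × Fin m → DSet m → Set
(a , b) ∈D S = lookup (lookup S a) b ≡ true

setD : ∀ {m} → Fin m → Fin m → Bool → DSet m → DSet m
setD a b x S = S [ a ]%= (λ row → row [ b ]≔ x)

IsDiag : ∀ {m} → Fin m → Fin m → Set
IsDiag {m} a b = suc (toℕ a) < toℕ b × ¬ (toℕ a ≡ 0 × suc (toℕ b) ≡ m)

IsSide : ∀ {m} → Fin m → Fin m → Set
IsSide {m} a b = suc (toℕ a) ≡ toℕ b ⊎ (toℕ a ≡ 0 × suc (toℕ b) ≡ m)

Cross : ∀ {m} → Fin m → Fin m → Fin m → Fin m → Set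
Cross a b c d =
    (toℕ a < toℕ c × toℕ c < toℕ b × toℕ b < toℕ d)
  ⊎ (toℕ c < toℕ a × toℕ a < toℕ d × toℕ d < toℕ b)

IsTriangulation : ∀ {m} → DSet m → Set
IsTriangulation {m} T =
    (∀ (a b : Fin m) → (a , b) ∈D T → IsDiag a b)
  × (∀ (a b c d : Fin m) → (a , b) ∈D T → (c , d) ∈D T → ¬ Cross a b c d)
  × (∀ (a b : Fin m) → IsDiag a b → ¬ ((a , b) ∈D T) →
       ∃[ c ] ∃[ d ] ((c , d) ∈D T × Cross a b c d))

Edge : ∀ {m} → DSet m → Fin m → Fin m → Set
Edge T x y =
    (toℕ x < toℕ y × (IsSide x y ⊎ (x , y) ∈D T))
  ⊎ (toℕ y < toℕ x × (IsSide y x ⊎ (y , x) ∈D T))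

norm : ∀ {m} → Fin m → Fin m → Fin m × Fin m
norm c d with toℕ c <ᵇ toℕ d
... | true  = c , d
... | false = d , c

-- Flipping the diagonal {a,b} (a < b) of T: the quadrilateral
-- (a, a', b, b') formed on deleting {a,b} has a' strictly between a and b
-- and b' outside; the result T' has {a',b'} (normalised as (x , y)) in
-- place of {a,b}.
Flip : ∀ {m} → DSet m → Fin m → Fin m → DSet m → Fin m × Fin m → Set
Flip T a b T' xy =
  (a , b) ∈D T ×
  ∃[ a' ] ∃[ b' ]
    ( (toℕ a < toℕ a' × toℕ a' < toℕ b)
    × (toℕ b' < toℕ a ⊎ toℕ b < toℕ b')
    × Edge T a a' × Edge T a' b × Edge T b b' × Edge T b' a
    × xy ≡ norm a' b'
    × T' ≡ setD (proj₁ xy) (proj₂ xy) true (setD a b false T))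

DPair : ℕ → Set
DPair m = DSet m × DSet m

FlipStep : ∀ {m} → DPair m → DPair m → Set
FlipStep (T₁ , T₂) Q =
    (∃[ a ] ∃[ b ] ∃[ T₁' ] ∃[ xy ] (Flip T₁ a b T₁' xy ×
       ((xy ∈D T₂ × ∃[ T₂' ] ∃[ uv ] (Flip T₂ (proj₁ xy) (proj₂ xy) T₂' uv × Q ≡ (T₁' , T₂')))
        ⊎ (¬ (xy ∈D T₂) × Q ≡ (T₁' , T₂)))))
  ⊎ (∃[ a ] ∃[ b ] ∃[ T₂' ] ∃[ xy ] (Flip T₂ a b T₂' xy ×
       ((xy ∈D T₁ × ∃[ T₁' ] ∃[ uv ] (Flip T₁ (proj₁ xy) (proj₂ xy) T₁' uv × Q ≡ (T₁' , T₂')))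
        ⊎ (¬ (xy ∈D T₁) × Q ≡ (T₁ , T₂')))))

DVertex : ℕ → Set
DVertex m = Σ (DPair m) λ P →
  IsTriangulation (proj₁ P) × IsTriangulation (proj₂ P) ×
  (∀ (a b : Fin m) → ¬ ((a , b) ∈D proj₁ P × (a , b) ∈D proj₂ P))

DAdj : ∀ {m} → DVertex m → DVertex m → Set
DAdj x y = FlipStep (proj₁ x) (proj₁ y) ⊎ FlipStep (proj₁ y) (proj₁ x)

-- Graph isomorphism.  Vertex sets are subtypes; two vertices are equal
-- when their underlying data (first components) are equal.

record GraphIso {V W : Set} (_≈V_ : V → V → Set) (_≈W_ : W → W → Set)
                (AV : V → V → Set) (AW : W → W → Set) : Set₁ where
  field
    to       : V → W
    from     : W → V
    to-cong  : ∀ {x y} → x ≈V y → to x ≈W to y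
    from-cong : ∀ {x y} → x ≈W y → from x ≈V from y
    from-to  : ∀ x → from (to x) ≈V x
    to-from  : ∀ y → to (from y) ≈W y
    adj      : ∀ x y → AV x y ⇔ AW (to x) (to y)

_≈L_ : ∀ {n} → Layout n → Layout n → Set
x ≈L y = proj₁ x ≡ proj₁ y

_≈D_ : ∀ {m} → DVertex m → DVertex m → Set
x ≈D y = proj₁ x ≡ proj₁ y

{-# OPTIONS --safe #-}
-- Number the leaves of a plane binary tree with n leaves 0, …, n - 1 from the top.  Every subtree
-- occupies an interval [a, b) of positions, and reading it as the chord {a, b} of the polygon with
-- vertices 0, …, n turns the intervals of the internal non-root vertices into the diagonals of a
-- triangulation, from which the tree is recovered: its left subtree ends at the farthest diagonal
-- from vertex 0.  A rotation changes exactly one interval: of the subtrees A, B, C below a vertex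
-- and its parent it trades A ∪ B for B ∪ C (or back), which is the flip of a diagonal of the
-- quadrilateral they span.  A proper subtanglegram is an interval common to both trees, i.e. a
-- common diagonal, so irreducible layouts are pairs of disjoint triangulations, and step (b) of
-- a rotation, which removes the common diagonal created by step (a), is the second flip in 𝒟ₙ₊₁.
module Submission where

open import Defs
open import Data.Nat using (ℕ; zero; suc; _+_; _≤_; _<_; _<ᵇ_; z≤n; s≤s; _≟_; _<?_; _≤?_)
open import Data.Nat.Properties
open import Data.Bool using (Bool; true; false; T)
open import Data.List using (List; []; _∷_; _++_; length)
open import Data.List.Properties using (∷-injective)
open import Data.Maybe using (just)
open import Data.Maybe.Properties using (just-injective)
open import Data.Product using (Σ; ∃-syntax; _×_; _,_; proj₁; proj₂; swap)
open import Data.Sum using (_⊎_; inj₁; inj₂; [_,_]′) renaming (map to ⊎-map)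
open import Data.Empty using (⊥; ⊥-elim)
open import Data.Unit using (tt)
open import Relation.Nullary using (¬_; Dec; yes; no; does; proof; _×-dec_; ¬?; contradiction)
open import Relation.Nullary.Decidable using (dec-true; dec-false; does-⇔)
open import Relation.Nullary.Reflects using (Reflects; invert)
open import Relation.Binary.PropositionalEquality
open import Function.Bundles using (mk⇔)
open import Data.Fin using (Fin; toℕ; fromℕ<)
open import Data.Fin.Properties using (toℕ-fromℕ<; toℕ<n; toℕ-injective; fromℕ<-toℕ)
import Data.Fin.Properties as Fin
open import Data.Vec using (lookup; tabulate)
open import Data.Vec.Properties using (lookup∘tabulate; tabulate∘lookup; tabulate-cong; lookup∘updateAt; lookup∘updateAt′; lookup∘update; lookup∘update′)
open import Relation.Binary.Definitions using (tri<; tri≈; tri>)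

data Cluster : ℕ → PTree → ℕ → ℕ → Set where
  whole : ∀ {k t a b} → a ≡ k → b ≡ k + leaves t → Cluster k t a b
  inL : ∀ {k l r a b} → Cluster k l a b → Cluster k (node l r) a b
  inR : ∀ {k l r a b} → Cluster (k + leaves l) r a b → Cluster k (node l r) a b

data Located : ℕ → PTree → Path → ℕ → PTree → Set where
  here : ∀ {k t} → Located k t [] k t
  goL : ∀ {k l r p k' s} → Located k l p k' s → Located k (node l r) (L ∷ p) k' s
  goR : ∀ {k l r p k' s} → Located (k + leaves l) r p k' s → Located k (node l r) (R ∷ p) k' s

leaves-positive : ∀ t → 1 ≤ leaves t
leaves-positive leaf = s≤s z≤n
leaves-positive (node l r) = ≤-trans (leaves-positive l) (m≤m+n (leaves l) (leaves r))

m<m+leaves : ∀ m t → m < m + leaves t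
m<m+leaves m t = m<m+n m (leaves-positive t)

cluster-start : ∀ {k t a b} → Cluster k t a b → k ≤ a
cluster-start (whole refl _) = ≤-refl
cluster-start (inL c) = cluster-start c
cluster-start {k} {node l r} (inR c) = ≤-trans (m≤m+n k (leaves l)) (cluster-start c)

cluster-nonempty : ∀ {k t a b} → Cluster k t a b → a < b
cluster-nonempty {k} {t} (whole refl refl) = m<m+leaves k t
cluster-nonempty (inL c) = cluster-nonempty c
cluster-nonempty (inR c) = cluster-nonempty c

cluster-end : ∀ {k t a b} → Cluster k t a b → b ≤ k + leaves t
cluster-end (whole _ refl) = ≤-refl
cluster-end {k} {node l r} (inL c) = ≤-trans (cluster-end c) (+-monoʳ-≤ k (m≤m+n (leaves l) (leaves r)))
cluster-end {k} {node l r} (inR c) = ≤-trans (cluster-end c) (≤-reflexive (+-assoc k (leaves l) (leaves r)))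

located-bounds : ∀ {k t p a s} → Located k t p a s → k ≤ a × a + leaves s ≤ k + leaves t
located-bounds here = ≤-refl , ≤-refl
located-bounds {k} {node l r} (goL x) with located-bounds x
... | p , q = p , ≤-trans q (+-monoʳ-≤ k (m≤m+n (leaves l) (leaves r)))
located-bounds {k} {node l r} (goR x) with located-bounds x
... | p , q = ≤-trans (m≤m+n k (leaves l)) p , ≤-trans q (≤-reflexive (+-assoc k (leaves l) (leaves r)))

located⇒cluster : ∀ {k t p a s} → Located k t p a s → Cluster k t a (a + leaves s)
located⇒cluster here = whole refl refl
located⇒cluster (goL x) = inL (located⇒cluster x)
located⇒cluster (goR x) = inR (located⇒cluster x)

cluster⇒located : ∀ {k t a b} → Cluster k t a b → Σ Path λ p → Σ PTree λ s → Located k t p a s × a + leaves s ≡ b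
cluster⇒located {t = t} (whole refl refl) = [] , t , here , refl
cluster⇒located (inL c) with cluster⇒located c
... | p , s , x , e = L ∷ p , s , goL x , e
cluster⇒located (inR c) with cluster⇒located c
... | p , s , x , e = R ∷ p , s , goR x , e

located⇒subtreeAt : ∀ {k t p a s} → Located k t p a s → subtreeAt t p ≡ just s
located⇒subtreeAt here = refl
located⇒subtreeAt (goL x) = located⇒subtreeAt x
located⇒subtreeAt (goR x) = located⇒subtreeAt x

subtreeAt⇒located : ∀ k t p {s} → subtreeAt t p ≡ just s → Σ ℕ λ a → Located k t p a s
subtreeAt⇒located k t [] refl = k , here
subtreeAt⇒located k leaf (d ∷ p) ()
subtreeAt⇒located k (node l r) (L ∷ p) e with subtreeAt⇒located k l p e
... | a , x = a , goL x
subtreeAt⇒located k (node l r) (R ∷ p) e with subtreeAt⇒located (k + leaves l) r p e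
... | a , x = a , goR x

located-unique : ∀ {k t p a s a' s'} → Located k t p a s → Located k t p a' s' → a ≡ a' × s ≡ s'
located-unique here here = refl , refl
located-unique (goL x) (goL y) = located-unique x y
located-unique (goR x) (goR y) = located-unique x y

located-root : ∀ {k t a s} → Located k t [] a s → a ≡ k × s ≡ t
located-root here = refl , refl

located-leaves≤ : ∀ {k t p a s} → Located k t p a s → leaves s ≤ leaves t
located-leaves≤ here = ≤-refl
located-leaves≤ {t = node l r} (goL x) = ≤-trans (located-leaves≤ x) (m≤m+n (leaves l) (leaves r))
located-leaves≤ {t = node l r} (goR x) = ≤-trans (located-leaves≤ x) (m≤n+m (leaves r) (leaves l))

located-nonroot-leaves< : ∀ {k t d p a s} → Located k t (d ∷ p) a s → leaves s < leaves t
located-nonroot-leaves< {t = node l r} (goL x) = ≤-<-trans (located-leaves≤ x) (m<m+n (leaves l) (leaves-positive r))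
located-nonroot-leaves< {t = node l r} (goR x) = ≤-<-trans (located-leaves≤ x) (m<n+m (leaves r) (leaves-positive l))

consecutive : ℕ → ℕ → List ℕ
consecutive k zero = []
consecutive k (suc n) = k ∷ consecutive (suc k) n

consecutive-++ : ∀ k a b → consecutive k a ++ consecutive (k + a) b ≡ consecutive k (a + b)
consecutive-++ k zero b = cong (λ z → consecutive z b) (+-identityʳ k)
consecutive-++ k (suc a) b = cong (k ∷_) (trans (cong (λ z → consecutive (suc k) a ++ consecutive z b) (+-suc k a)) (consecutive-++ (suc k) a b))

length-consecutive : ∀ k n → length (consecutive k n) ≡ n
length-consecutive k zero = refl
length-consecutive k (suc n) = cong suc (length-consecutive (suc k) n)

consecutive-injective : ∀ {a b} m n → 1 ≤ m → consecutive a m ≡ consecutive b n → a ≡ b × m ≡ n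
consecutive-injective {a} {b} (suc m) (suc n) _ e =
  proj₁ (∷-injective e) , trans (sym (length-consecutive a (suc m))) (trans (cong length e) (length-consecutive b (suc n)))

leafIdx≡consecutive : ∀ k t → leafIdx k t ≡ consecutive k (leaves t)
leafIdx≡consecutive k leaf = refl
leafIdx≡consecutive k (node l r) = trans (cong₂ _++_ (leafIdx≡consecutive k l) (leafIdx≡consecutive (k + leaves l) r)) (consecutive-++ k (leaves l) (leaves r))

located⇒descLeaves : ∀ {k t p a s} → Located k t p a s → descLeaves k t p ≡ just (consecutive a (leaves s))
located⇒descLeaves {k} {t} here = cong just (leafIdx≡consecutive k t)
located⇒descLeaves (goL x) = located⇒descLeaves x
located⇒descLeaves (goR x) = located⇒descLeaves x

clusters-noncrossing : ∀ {k t a b c d} → Cluster k t a b → Cluster k t c d → a < c → c < b → b < d → ⊥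
clusters-noncrossing (whole _ refl) y ac cb bd = <⇒≱ bd (cluster-end y)
clusters-noncrossing x (whole refl _) ac cb bd = <⇒≱ ac (cluster-start x)
clusters-noncrossing (inL x) (inL y) ac cb bd = clusters-noncrossing x y ac cb bd
clusters-noncrossing (inR x) (inR y) ac cb bd = clusters-noncrossing x y ac cb bd
clusters-noncrossing (inL x) (inR y) ac cb bd = <⇒≱ cb (≤-trans (cluster-end x) (cluster-start y))
clusters-noncrossing (inR x) (inL y) ac cb bd = <⇒≱ (<-trans ac (<-trans cb bd)) (≤-trans (cluster-end y) (cluster-start x))

cluster? : ∀ k t a b → Dec (Cluster k t a b)
cluster? k leaf a b with a ≟ k | b ≟ k + 1
... | yes p | yes q = yes (whole p q)
... | no p | _ = no λ { (whole x _) → p x }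
... | yes _ | no q = no λ { (whole _ y) → q y }
cluster? k (node l r) a b with a ≟ k | b ≟ k + leaves (node l r) | cluster? k l a b | cluster? (k + leaves l) r a b
... | yes p | yes q | _ | _ = yes (whole p q)
... | _ | _ | yes c | _ = yes (inL c)
... | _ | _ | _ | yes c = yes (inR c)
... | no p | _ | no c1 | no c2 = no λ { (whole x y) → p x ; (inL z) → c1 z ; (inR z) → c2 z }
... | yes _ | no q | no c1 | no c2 = no λ { (whole x y) → q y ; (inL z) → c1 z ; (inR z) → c2 z }

unit-cluster : ∀ k t a → k ≤ a → a < k + leaves t → Cluster k t a (suc a)
unit-cluster k leaf a p q = whole a≡k (trans (cong suc a≡k) (+-comm 1 k))
  where
  a≡k : a ≡ k
  a≡k = ≤-antisym (≤-pred (≤-trans q (≤-reflexive (+-comm k 1)))) p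
unit-cluster k (node l r) a p q with a <? k + leaves l
... | yes a<s = inL (unit-cluster k l a p a<s)
... | no a≮s = inR (unit-cluster (k + leaves l) r a (≮⇒≥ a≮s) (<-≤-trans q (≤-reflexive (sym (+-assoc k (leaves l) (leaves r))))))

Crossℕ : ℕ → ℕ → ℕ → ℕ → Set
Crossℕ a b c d = (a < c × c < b × b < d) ⊎ (c < a × a < d × d < b)

cluster-or-crossing : ∀ k t a b → k ≤ a → a < b → b ≤ k + leaves t → ¬ Cluster k t a b →
         Σ ℕ λ c → Σ ℕ λ d → Cluster k t c d × Crossℕ a b c d
cluster-or-crossing k leaf a b ka ab bk nc = ⊥-elim (nc (whole a≡k b≡))
  where
  a≡k : a ≡ k
  a≡k = ≤-antisym (≤-pred (≤-trans (<-≤-trans ab bk) (≤-reflexive (+-comm k 1)))) ka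
  b≡ : b ≡ k + 1
  b≡ = ≤-antisym bk (≤-trans (≤-reflexive (+-comm k 1)) (≤-trans (s≤s (≤-reflexive (sym a≡k))) ab))
cluster-or-crossing k (node l r) a b ka ab bk nc with b ≤? k + leaves l | k + leaves l ≤? a
... | yes b≤s | _ with cluster-or-crossing k l a b ka ab b≤s (λ c → nc (inL c))
...   | c , d , x , cr = c , d , inL x , cr
cluster-or-crossing k (node l r) a b ka ab bk nc | no b≰s | yes s≤a
  with cluster-or-crossing (k + leaves l) r a b s≤a ab (≤-trans bk (≤-reflexive (sym (+-assoc k (leaves l) (leaves r))))) (λ c → nc (inR c))
... | c , d , x , cr = c , d , inR x , cr
cluster-or-crossing k (node l r) a b ka ab bk nc | no b≰s | no s≰a with a ≟ k | b ≟ k + leaves (node l r)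
... | yes a≡k | yes b≡e = ⊥-elim (nc (whole a≡k b≡e))
... | yes a≡k | no b≢e = k + leaves l , k + leaves l + leaves r , inR (whole refl refl) ,
       inj₁ (≰⇒> s≰a , ≰⇒> b≰s , <-≤-trans (≤∧≢⇒< bk b≢e) (≤-reflexive (sym (+-assoc k (leaves l) (leaves r)))))
... | no a≢k | _ = k , k + leaves l , inL (whole refl refl) ,
       inj₂ (≤∧≢⇒< ka (λ e → a≢k (sym e)) , ≰⇒> s≰a , ≰⇒> b≰s)

cluster-restrictˡ : ∀ {k l r a b} → Cluster k (node l r) a b → b ≤ k + leaves l → Cluster k l a b
cluster-restrictˡ {k} {l} {r} (whole _ refl) bs = ⊥-elim (<⇒≱ (+-monoʳ-< k (m<m+n (leaves l) (leaves-positive r))) bs)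
cluster-restrictˡ (inL x) bs = x
cluster-restrictˡ (inR x) bs = ⊥-elim (<⇒≱ (cluster-nonempty x) (≤-trans bs (cluster-start x)))

cluster-restrictʳ : ∀ {k l r a b} → Cluster k (node l r) a b → k + leaves l ≤ a → Cluster (k + leaves l) r a b
cluster-restrictʳ {k} {l} {r} (whole refl _) sa = ⊥-elim (<⇒≱ (m<m+n k (leaves-positive l)) sa)
cluster-restrictʳ (inL x) sa = ⊥-elim (<⇒≱ (cluster-nonempty x) (≤-trans (cluster-end x) sa))
cluster-restrictʳ (inR x) sa = x

cluster-reoffset : ∀ {k t k' a b} → k ≡ k' → Cluster k t a b → Cluster k' t a b
cluster-reoffset refl c = c

prefix-cluster-ends-in-left : ∀ {k l r b} → Cluster k (node l r) k b → b < k + leaves (node l r) → b ≤ k + leaves l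
prefix-cluster-ends-in-left (whole _ refl) lt = ⊥-elim (<-irrefl refl lt)
prefix-cluster-ends-in-left (inL x) lt = cluster-end x
prefix-cluster-ends-in-left {k} {l} (inR x) lt = ⊥-elim (<⇒≱ (m<m+n k (leaves-positive l)) (cluster-start x))

clusters-determine-tree : ∀ k t t' → leaves t ≡ leaves t' → (∀ a b → Cluster k t a b → Cluster k t' a b) →
         (∀ a b → Cluster k t' a b → Cluster k t a b) → t ≡ t'
clusters-determine-tree k leaf leaf e f g = refl
clusters-determine-tree k leaf (node l r) e f g = ⊥-elim (<⇒≢ (+-mono-≤ (leaves-positive l) (leaves-positive r)) e)
clusters-determine-tree k (node l r) leaf e f g = ⊥-elim (<⇒≢ (+-mono-≤ (leaves-positive l) (leaves-positive r)) (sym e))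
clusters-determine-tree k (node l r) (node l' r') e f g = cong₂ node eql eqr
  where
  ll : leaves l ≤ leaves l'
  ll = +-cancelˡ-≤ k _ _ (prefix-cluster-ends-in-left (f k (k + leaves l) (inL (whole refl refl)))
         (<-≤-trans (+-monoʳ-< k (m<m+n (leaves l) (leaves-positive r))) (≤-reflexive (cong (k +_) e))))
  ll' : leaves l' ≤ leaves l
  ll' = +-cancelˡ-≤ k _ _ (prefix-cluster-ends-in-left (g k (k + leaves l') (inL (whole refl refl)))
         (<-≤-trans (+-monoʳ-< k (m<m+n (leaves l') (leaves-positive r'))) (≤-reflexive (cong (k +_) (sym e)))))
  el : leaves l ≡ leaves l'
  el = ≤-antisym ll ll'
  eql : l ≡ l'
  eql = clusters-determine-tree k l l' el
    (λ a b c → cluster-restrictˡ (f a b (inL c)) (≤-trans (cluster-end c) (≤-reflexive (cong (k +_) el))))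
    (λ a b c → cluster-restrictˡ (g a b (inL c)) (≤-trans (cluster-end c) (≤-reflexive (cong (k +_) (sym el)))))
  er : leaves r ≡ leaves r'
  er = +-cancelˡ-≡ (leaves l) _ _ (trans e (cong (_+ leaves r') (sym el)))
  ks : k + leaves l ≡ k + leaves l'
  ks = cong (k +_) el
  eqr : r ≡ r'
  eqr = clusters-determine-tree (k + leaves l) r r' er
    (λ a b c → cluster-reoffset (sym ks) (cluster-restrictʳ (f a b (inR c)) (≤-trans (≤-reflexive (sym ks)) (cluster-start c))))
    (λ a b c → cluster-restrictʳ (g a b (inR (cluster-reoffset ks c))) (cluster-start c))

-- The triangulation of a tree

Diagonal : ℕ → ℕ → ℕ → Set
Diagonal m a b = suc a < b × ¬ (a ≡ 0 × suc b ≡ m)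

diagonal? : ∀ m a b → Dec (Diagonal m a b)
diagonal? m a b = (suc a <? b) ×-dec ¬? ((a ≟ 0) ×-dec (suc b ≟ m))

diagonals : PTree → (m : ℕ) → DSet m
diagonals t m = tabulate λ a → tabulate λ b → does (diagonal? m (toℕ a) (toℕ b) ×-dec cluster? 0 t (toℕ a) (toℕ b))

diagonals-entry : ∀ t m (a b : Fin m) → lookup (lookup (diagonals t m) a) b ≡ does (diagonal? m (toℕ a) (toℕ b) ×-dec cluster? 0 t (toℕ a) (toℕ b))
diagonals-entry t m a b = trans (cong (λ v → lookup v b) (lookup∘tabulate _ a)) (lookup∘tabulate _ b)

∈diagonals⇒ : ∀ {t m} {a b : Fin m} → (a , b) ∈D diagonals t m → Diagonal m (toℕ a) (toℕ b) × Cluster 0 t (toℕ a) (toℕ b)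
∈diagonals⇒ {t} {m} {a} {b} e = invert (subst (Reflects _) (trans (sym (diagonals-entry t m a b)) e) (proof (diagonal? m (toℕ a) (toℕ b) ×-dec cluster? 0 t (toℕ a) (toℕ b))))

∈diagonals⇐ : ∀ {t m} {a b : Fin m} → Diagonal m (toℕ a) (toℕ b) → Cluster 0 t (toℕ a) (toℕ b) → (a , b) ∈D diagonals t m
∈diagonals⇐ {t} {m} {a} {b} d c = trans (diagonals-entry t m a b) (dec-true (diagonal? m (toℕ a) (toℕ b) ×-dec cluster? 0 t (toℕ a) (toℕ b)) (d , c))

∈diagonals⇐′ : ∀ {t m} (a b : Fin m) {x y} → toℕ a ≡ x → toℕ b ≡ y → Diagonal m x y → Cluster 0 t x y → (a , b) ∈D diagonals t m
∈diagonals⇐′ a b refl refl d c = ∈diagonals⇐ d c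

vertex : ∀ {n} x → x ≤ n → Fin (suc n)
vertex x p = fromℕ< (s≤s p)

toℕ-vertex : ∀ {n} x (p : x ≤ n) → toℕ (vertex x p) ≡ x
toℕ-vertex x p = toℕ-fromℕ< (s≤s p)

toℕ≤ : ∀ {n} (a : Fin (suc n)) → toℕ a ≤ n
toℕ≤ a = ≤-pred (toℕ<n a)

crossing⇒diagonal : ∀ {n a b c d} → b ≤ n → Crossℕ a b c d → Diagonal (suc n) c d
crossing⇒diagonal bn (inj₁ (ac , cb , bd)) = ≤-trans (s≤s cb) bd , λ { (c0 , _) → <⇒≢ (≤-<-trans z≤n ac) (sym c0) }
crossing⇒diagonal bn (inj₂ (ca , ad , db)) = ≤-trans (s≤s ca) ad , λ { (_ , dn) → <⇒≱ db (≤-trans bn (≤-reflexive (sym (suc-injective dn)))) }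

diagonals-triangulation : ∀ n t → leaves t ≡ n → IsTriangulation (diagonals t (suc n))
diagonals-triangulation n t lt = (λ a b m → proj₁ (∈diagonals⇒ {t} m)) ,
              (λ a b c d m1 m2 cr → noncrossing (proj₂ (∈diagonals⇒ {t} m1)) (proj₂ (∈diagonals⇒ {t} m2)) cr) ,
              maximal
  where
  noncrossing : ∀ {a b c d} → Cluster 0 t a b → Cluster 0 t c d → Crossℕ a b c d → ⊥
  noncrossing x y (inj₁ (p , q , r)) = clusters-noncrossing x y p q r
  noncrossing x y (inj₂ (p , q , r)) = clusters-noncrossing y x p q r
  maximal : ∀ (a b : Fin (suc n)) → IsDiag a b → ¬ ((a , b) ∈D diagonals t (suc n)) →
         ∃[ c ] ∃[ d ] ((c , d) ∈D diagonals t (suc n) × Cross a b c d)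
  maximal a b dg nm with cluster-or-crossing 0 t (toℕ a) (toℕ b) z≤n (<-trans (n<1+n _) (proj₁ dg)) (≤-trans (toℕ≤ b) (≤-reflexive (sym lt))) (λ c → nm (∈diagonals⇐ dg c))
  ... | c , d , cl , cr = vertex c cn , vertex d dn , ∈diagonals⇐′ (vertex c cn) (vertex d dn) (toℕ-vertex c cn) (toℕ-vertex d dn) (crossing⇒diagonal (toℕ≤ b) cr) cl ,
        subst₂ (λ u v → Crossℕ (toℕ a) (toℕ b) u v) (sym (toℕ-vertex c cn)) (sym (toℕ-vertex d dn)) cr
    where
    dn : d ≤ n
    dn = ≤-trans (cluster-end cl) (≤-reflexive lt)
    cn : c ≤ n
    cn = ≤-trans (<⇒≤ (cluster-nonempty cl)) dn

cluster⇒edge : ∀ {n t} → leaves t ≡ n → (x y : Fin (suc n)) → toℕ x < toℕ y → Cluster 0 t (toℕ x) (toℕ y) → Edge (diagonals t (suc n)) x y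
cluster⇒edge {n} lt x y xy c with suc (toℕ x) ≟ toℕ y | toℕ x ≟ 0 | suc (toℕ y) ≟ suc n
... | yes e | _ | _ = inj₁ (xy , inj₁ (inj₁ e))
... | no _ | yes x0 | yes yn = inj₁ (xy , inj₁ (inj₂ (x0 , yn)))
... | no ne | yes x0 | no yn = inj₁ (xy , inj₂ (∈diagonals⇐ (≤∧≢⇒< xy ne , λ { (_ , e) → yn e }) c))
... | no ne | no x0 | _ = inj₁ (xy , inj₂ (∈diagonals⇐ (≤∧≢⇒< xy ne , λ { (e , _) → x0 e }) c))

cluster⇒edge′ : ∀ {n t} → leaves t ≡ n → (x y : Fin (suc n)) → toℕ y < toℕ x → Cluster 0 t (toℕ y) (toℕ x) → Edge (diagonals t (suc n)) x y
cluster⇒edge′ lt x y yx c with cluster⇒edge lt y x yx c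
... | inj₁ (p , q) = inj₂ (p , q)
... | inj₂ (p , q) = ⊥-elim (<-asym p yx)

side⇒cluster : ∀ {n t} → leaves t ≡ n → (x y : Fin (suc n)) → IsSide x y → Cluster 0 t (toℕ x) (toℕ y)
side⇒cluster {n} {t} lt x y (inj₁ e) = subst (Cluster 0 t (toℕ x)) e (unit-cluster 0 t (toℕ x) z≤n (≤-trans (≤-trans (≤-reflexive e) (toℕ≤ y)) (≤-reflexive (sym lt))))
side⇒cluster {n} {t} lt x y (inj₂ (x0 , yn)) = whole x0 (trans (suc-injective yn) (sym lt))

edge⇒cluster : ∀ {n t} → leaves t ≡ n → (x y : Fin (suc n)) → Edge (diagonals t (suc n)) x y → toℕ x < toℕ y → Cluster 0 t (toℕ x) (toℕ y)
edge⇒cluster lt x y (inj₁ (_ , inj₁ s)) xy = side⇒cluster lt x y s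
edge⇒cluster lt x y (inj₁ (_ , inj₂ m)) xy = proj₂ (∈diagonals⇒ m)
edge⇒cluster lt x y (inj₂ (yx , _)) xy = ⊥-elim (<-asym xy yx)

edge⇒cluster′ : ∀ {n t} → leaves t ≡ n → (x y : Fin (suc n)) → Edge (diagonals t (suc n)) x y → toℕ y < toℕ x → Cluster 0 t (toℕ y) (toℕ x)
edge⇒cluster′ lt x y (inj₂ (_ , inj₁ s)) yx = side⇒cluster lt y x s
edge⇒cluster′ lt x y (inj₂ (_ , inj₂ m)) yx = proj₂ (∈diagonals⇒ m)
edge⇒cluster′ lt x y (inj₁ (xy , _)) yx = ⊥-elim (<-asym xy yx)

-- Recovering a tree from its triangulation

dset-ext : ∀ {m} (A B : DSet m) → (∀ x y → lookup (lookup A x) y ≡ lookup (lookup B x) y) → A ≡ B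
dset-ext A B h = trans (sym (tabulate∘lookup A))
  (trans (tabulate-cong (λ x → trans (sym (tabulate∘lookup (lookup A x)))
                                (trans (tabulate-cong (h x)) (tabulate∘lookup (lookup B x)))))
         (tabulate∘lookup B))

triangulation-⊆⇒≡ : ∀ {m} {T T' : DSet m} → IsTriangulation T → IsTriangulation T' →
                     (∀ a b → (a , b) ∈D T → (a , b) ∈D T') → T ≡ T'
triangulation-⊆⇒≡ {T = T} {T'} (_ , _ , maximal) (diagonal' , noncrossing' , _) T⊆T' = dset-ext T T' entry
  where
  entry : ∀ a b → lookup (lookup T a) b ≡ lookup (lookup T' a) b
  entry a b with lookup (lookup T a) b in ab∈T | lookup (lookup T' a) b in ab∈T'
  ... | true | true = refl
  ... | false | false = refl
  ... | true | false = contradiction (trans (sym (T⊆T' a b ab∈T)) ab∈T') λ ()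
  ... | false | true with maximal a b (diagonal' a b ab∈T') (λ ab∈T″ → contradiction (trans (sym ab∈T″) ab∈T) λ ())
  ...   | c , d , cd∈T , cross = ⊥-elim (noncrossing' a b c d ab∈T' (T⊆T' c d cd∈T) cross)

clusters-transfer : ∀ {n t t'} → leaves t ≡ n → leaves t' ≡ n → diagonals t (suc n) ≡ diagonals t' (suc n) →
                    ∀ a b → Cluster 0 t a b → Cluster 0 t' a b
clusters-transfer {n} {t} {t'} lt lt' eq a b c with suc a <? b | (a ≟ 0) ×-dec (suc b ≟ suc n)
... | no a+1≮b | _ = subst (Cluster 0 t' a) (≤-antisym (cluster-nonempty c) (≮⇒≥ a+1≮b))
                        (unit-cluster 0 t' a z≤n (<-≤-trans (cluster-nonempty c) (≤-trans (cluster-end c) (≤-reflexive (trans lt (sym lt'))))))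
... | yes _ | yes (a≡0 , b≡n) = whole a≡0 (trans (suc-injective b≡n) (sym lt'))
... | yes a+1<b | no ¬side = subst₂ (Cluster 0 t') (toℕ-vertex a a≤n) (toℕ-vertex b b≤n) (proj₂ (∈diagonals⇒ {t'} ∈t'))
  where
  b≤n : b ≤ n
  b≤n = ≤-trans (cluster-end c) (≤-reflexive lt)
  a≤n : a ≤ n
  a≤n = ≤-trans (<⇒≤ (cluster-nonempty c)) b≤n
  ∈t : (vertex a a≤n , vertex b b≤n) ∈D diagonals t (suc n)
  ∈t = ∈diagonals⇐′ (vertex a a≤n) (vertex b b≤n) (toℕ-vertex a a≤n) (toℕ-vertex b b≤n) (a+1<b , ¬side) c
  ∈t' : (vertex a a≤n , vertex b b≤n) ∈D diagonals t' (suc n)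
  ∈t' = subst (λ M → (vertex a a≤n , vertex b b≤n) ∈D M) eq ∈t

diagonals-injective : ∀ {n t t'} → leaves t ≡ n → leaves t' ≡ n → diagonals t (suc n) ≡ diagonals t' (suc n) → t ≡ t'
diagonals-injective lt lt' eq = clusters-determine-tree 0 _ _ (trans lt (sym lt')) (clusters-transfer lt lt' eq) (clusters-transfer lt' lt (sym eq))

record Laminar (f : ℕ → ℕ → Bool) : Set where
  field
    nonside : ∀ x y → f x y ≡ true → suc x < y
    noncrossing : ∀ x y u v → f x y ≡ true → f u v ≡ true → x < u → u < y → y < v → ⊥

-- splitPoint f a j = (i , r) with i + r ≡ j: the leaves a, …, a + j + 1 split as [a, a + i + 1) and the
-- rest, where a + i + 1 is the largest c with a + 1 < c ≤ a + j + 1 and f c ≡ true (a + 1 if there is none).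
splitPoint : (ℕ → Bool) → ℕ → ℕ → ℕ × ℕ
splitPoint f a zero = 0 , 0
splitPoint f a (suc j) with f (a + suc (suc j))
... | true = suc j , 0
... | false = proj₁ (splitPoint f a j) , suc (proj₂ (splitPoint f a j))

splitPoint-sum : ∀ f a j → proj₁ (splitPoint f a j) + proj₂ (splitPoint f a j) ≡ j
splitPoint-sum f a zero = refl
splitPoint-sum f a (suc j) with f (a + suc (suc j))
... | true = +-identityʳ (suc j)
... | false = trans (+-suc _ _) (cong suc (splitPoint-sum f a j))

splitPoint-last : ∀ f a j y → a + suc (proj₁ (splitPoint f a j)) < y → y < a + suc (suc j) → f y ≡ false
splitPoint-last f a zero y p q = ⊥-elim (<⇒≱ p (≤-pred (≤-trans q (≤-reflexive (+-suc a 1)))))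
splitPoint-last f a (suc j) y p q with f (a + suc (suc j)) in eq
... | true = ⊥-elim (<⇒≱ p (≤-pred (≤-trans q (≤-reflexive (+-suc a (suc (suc j)))))))
... | false with y ≟ a + suc (suc j)
...   | yes refl = eq
...   | no ne = splitPoint-last f a j y p (≤∧≢⇒< (≤-pred (≤-trans q (≤-reflexive (+-suc a (suc (suc j)))))) ne)

splitPoint-hit : ∀ f a j → proj₁ (splitPoint f a j) ≡ 0 ⊎ f (a + suc (proj₁ (splitPoint f a j))) ≡ true
splitPoint-hit f a zero = inj₁ refl
splitPoint-hit f a (suc j) with f (a + suc (suc j)) in eq
... | true = inj₂ eq
... | false = splitPoint-hit f a j

leftSize rightSize : (ℕ → ℕ → Bool) → ℕ → ℕ → ℕ
leftSize f a j = suc (proj₁ (splitPoint (f a) a j))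
rightSize f a j = suc (proj₂ (splitPoint (f a) a j))

leftSize+rightSize : ∀ f a j → leftSize f a j + rightSize f a j ≡ suc (suc j)
leftSize+rightSize f a j = cong suc (trans (+-suc _ _) (cong suc (splitPoint-sum (f a) a j)))

leftSize≤ : ∀ f a j → leftSize f a j ≤ suc j
leftSize≤ f a j = s≤s (≤-trans (m≤m+n _ _) (≤-reflexive (splitPoint-sum (f a) a j)))

rightSize≤ : ∀ f a j → rightSize f a j ≤ suc j
rightSize≤ f a j = s≤s (≤-trans (m≤n+m _ _) (≤-reflexive (splitPoint-sum (f a) a j)))

-- build f fuel a len: the tree on the leaves a, …, a + len - 1 whose diagonals are the chords {x, y} with
-- f x y ≡ true; the fuel bounds the recursion depth and must be at least len.
build : (ℕ → ℕ → Bool) → ℕ → ℕ → ℕ → PTree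
build f zero a len = leaf
build f (suc fuel) a zero = leaf
build f (suc fuel) a (suc zero) = leaf
build f (suc fuel) a (suc (suc j)) = node (build f fuel a (leftSize f a j)) (build f fuel (a + leftSize f a j) (rightSize f a j))

leaves-build : ∀ f fuel a len → 1 ≤ len → len ≤ fuel → leaves (build f fuel a len) ≡ len
leaves-build f zero a len p q = ⊥-elim (<⇒≱ p q)
leaves-build f (suc fuel) a (suc zero) p q = refl
leaves-build f (suc fuel) a (suc (suc j)) p q =
  trans (cong₂ _+_ (leaves-build f fuel a (leftSize f a j) (s≤s z≤n) (≤-trans (leftSize≤ f a j) (≤-pred q)))
                   (leaves-build f fuel (a + leftSize f a j) (rightSize f a j) (s≤s z≤n) (≤-trans (rightSize≤ f a j) (≤-pred q))))
        (leftSize+rightSize f a j)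

module _ {f : ℕ → ℕ → Bool} (laminar : Laminar f) where
  open Laminar laminar

  straddling-chord-spans : ∀ a j x y → a ≤ x → x < a + leftSize f a j → a + leftSize f a j < y → y ≤ a + suc (suc j) →
                           f x y ≡ true → x ≡ a × y ≡ a + suc (suc j)
  straddling-chord-spans a j x y a≤x x<c c<y y≤e fxy with x ≟ a
  ... | no x≢a = ⊥-elim ([ (λ i≡0 → <⇒≱ a<x (≤-pred (≤-trans x<c (≤-reflexive (trans (cong (λ z → a + suc z) i≡0) (+-comm a 1))))))
                          , (λ fac → noncrossing a (a + leftSize f a j) x y fac fxy a<x x<c c<y) ]′ (splitPoint-hit (f a) a j))
    where
    a<x : a < x
    a<x = ≤∧≢⇒< a≤x (λ e → x≢a (sym e))
  ... | yes refl with y ≟ a + suc (suc j)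
  ...   | yes y≡e = refl , y≡e
  ...   | no y≢e = contradiction (trans (sym fxy) (splitPoint-last (f a) a j y c<y (≤∧≢⇒< y≤e y≢e))) λ ()

  build-clusters : ∀ fuel a len → 1 ≤ len → len ≤ fuel →
                   ∀ x y → a ≤ x → y ≤ a + len → f x y ≡ true → Cluster a (build f fuel a len) x y
  build-clusters zero a len p q = ⊥-elim (<⇒≱ p q)
  build-clusters (suc fuel) a (suc zero) p q x y a≤x y≤e fxy =
    ⊥-elim (<⇒≱ (nonside x y fxy) (≤-trans y≤e (≤-trans (≤-reflexive (+-comm a 1)) (s≤s a≤x))))
  build-clusters (suc fuel) a (suc (suc j)) p q x y a≤x y≤e fxy with y ≤? a + leftSize f a j | a + leftSize f a j ≤? x
  ... | yes y≤c | _ = inL (build-clusters fuel a (leftSize f a j) (s≤s z≤n) (≤-trans (leftSize≤ f a j) (≤-pred q)) x y a≤x y≤c fxy)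
  ... | no _ | yes c≤x = inR (cluster-reoffset (cong (a +_) (sym (leaves-build f fuel a (leftSize f a j) (s≤s z≤n) (≤-trans (leftSize≤ f a j) (≤-pred q)))))
          (build-clusters fuel (a + leftSize f a j) (rightSize f a j) (s≤s z≤n) (≤-trans (rightSize≤ f a j) (≤-pred q)) x y c≤x
            (≤-trans y≤e (≤-reflexive (trans (cong (a +_) (sym (leftSize+rightSize f a j))) (sym (+-assoc a _ _))))) fxy))
  ... | no y≰c | no c≰x with straddling-chord-spans a j x y a≤x (≰⇒> c≰x) (≰⇒> y≰c) y≤e fxy
  ...   | x≡a , y≡e = whole x≡a (trans y≡e (cong (a +_) (sym (leaves-build f (suc fuel) a (suc (suc j)) p q))))

entryℕ : ∀ {n} → DSet (suc n) → ℕ → ℕ → Bool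
entryℕ {n} T a b with a <? suc n | b <? suc n
... | yes p | yes q = lookup (lookup T (fromℕ< p)) (fromℕ< q)
... | _ | _ = false

entryℕ-toℕ : ∀ {n} (T : DSet (suc n)) (x y : Fin (suc n)) → entryℕ T (toℕ x) (toℕ y) ≡ lookup (lookup T x) y
entryℕ-toℕ {n} T x y with toℕ x <? suc n | toℕ y <? suc n
... | yes p | yes q = cong₂ (λ u v → lookup (lookup T u) v) (fromℕ<-toℕ x p) (fromℕ<-toℕ y q)
... | no p | _ = ⊥-elim (p (toℕ<n x))
... | yes _ | no q = ⊥-elim (q (toℕ<n y))

entryℕ-true : ∀ {n} (T : DSet (suc n)) a b → entryℕ T a b ≡ true →
              Σ (Fin (suc n)) λ x → Σ (Fin (suc n)) λ y → toℕ x ≡ a × toℕ y ≡ b × (x , y) ∈D T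
entryℕ-true {n} T a b e with a <? suc n | b <? suc n
... | yes p | yes q = fromℕ< p , fromℕ< q , toℕ-fromℕ< p , toℕ-fromℕ< q , e
entryℕ-true {n} T a b () | no _ | _
entryℕ-true {n} T a b () | yes _ | no _

triangulation-laminar : ∀ {n} {T : DSet (suc n)} → IsTriangulation T → Laminar (entryℕ T)
triangulation-laminar {T = T} (diagonal , noncrossing , _) = record { nonside = nonside ; noncrossing = noncrossing′ }
  where
  nonside : ∀ x y → entryℕ T x y ≡ true → suc x < y
  nonside x y e with entryℕ-true T x y e
  ... | x' , y' , refl , refl , m = proj₁ (diagonal x' y' m)
  noncrossing′ : ∀ x y u v → entryℕ T x y ≡ true → entryℕ T u v ≡ true → x < u → u < y → y < v → ⊥
  noncrossing′ x y u v e₁ e₂ x<u u<y y<v with entryℕ-true T x y e₁ | entryℕ-true T u v e₂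
  ... | x' , y' , refl , refl , m₁ | u' , v' , refl , refl , m₂ = noncrossing x' y' u' v' m₁ m₂ (inj₁ (x<u , u<y , y<v))

treeOf : ∀ {n} → DSet (suc n) → PTree
treeOf {n} T = build (entryℕ T) n 0 n

leaves-treeOf : ∀ {n} (T : DSet (suc n)) → 1 ≤ n → leaves (treeOf T) ≡ n
leaves-treeOf {n} T p = leaves-build (entryℕ T) n 0 n p ≤-refl

diagonals-treeOf : ∀ {n} (T : DSet (suc n)) → 1 ≤ n → IsTriangulation T → diagonals (treeOf T) (suc n) ≡ T
diagonals-treeOf {n} T p tri = sym (triangulation-⊆⇒≡ tri (diagonals-triangulation n (treeOf T) (leaves-treeOf T p)) T⊆)
  where
  T⊆ : ∀ x y → (x , y) ∈D T → (x , y) ∈D diagonals (treeOf T) (suc n)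
  T⊆ x y m = ∈diagonals⇐ (proj₁ tri x y m)
    (build-clusters (triangulation-laminar tri) n 0 n p ≤-refl (toℕ x) (toℕ y) z≤n (toℕ≤ y) (trans (entryℕ-toℕ T x y) m))

treeOf-diagonals : ∀ {n t} → leaves t ≡ n → 1 ≤ n → treeOf (diagonals t (suc n)) ≡ t
treeOf-diagonals {n} {t} lt p = diagonals-injective (leaves-treeOf _ p) lt (diagonals-treeOf _ p (diagonals-triangulation n t lt))

-- A rotation exchanges one cluster

Exchanged : ℕ → PTree → ℕ → ℕ → ℕ → ℕ → ℕ → ℕ → Set
Exchanged k t a b a' b' x y = (Cluster k t x y × ¬ (x ≡ a × y ≡ b)) ⊎ (x ≡ a' × y ≡ b')

-- The rotation at w acts on the subtrees A, B, C of w and its parent, spanning [i, j), [j, q), [q, l):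
-- the cluster [oL, oR) of w (A ∪ B or B ∪ C) becomes [nL, nR) (the other union), all others stay.
record RotationShape (k : ℕ) (t : PTree) (w : Path) : Set where
  constructor mkRotationShape
  field
    i j q l : ℕ
    i<j : i < j
    j<q : j < q
    q<l : q < l
    oL oR nL nR : ℕ
    shape : (oL ≡ i × oR ≡ q × nL ≡ j × nR ≡ l) ⊎ (oL ≡ j × oR ≡ l × nL ≡ i × nR ≡ q)
    cluster-il : Cluster k t i l
    cluster-ij : Cluster k t i j
    cluster-jq : Cluster k t j q
    cluster-ql : Cluster k t q l
    sub : PTree
    sub-located : Located k t w oL sub
    sub-end : oL + leaves sub ≡ oR
    rotate-clusters⇒ : ∀ x y → Cluster k (rotate w t) x y → Exchanged k t oL oR nL nR x y
    rotate-clusters⇐ : ∀ x y → Exchanged k t oL oR nL nR x y → Cluster k (rotate w t) x y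
    leaves-rotate : leaves (rotate w t) ≡ leaves t

≢⇒¬×≡ˡ : ∀ {x y a b : ℕ} → x ≢ a → ¬ (x ≡ a × y ≡ b)
≢⇒¬×≡ˡ n (e , _) = n e

≢⇒¬×≡ʳ : ∀ {x y a b : ℕ} → y ≢ b → ¬ (x ≡ a × y ≡ b)
≢⇒¬×≡ʳ n (_ , e) = n e

k+[a+b+c]≡k+a+b+c : ∀ k a b c → k + (a + b + c) ≡ k + a + b + c
k+[a+b+c]≡k+a+b+c k a b c = trans (sym (+-assoc k (a + b) c)) (cong (_+ c) (sym (+-assoc k a b)))

k+a+[b+c]≡k+a+b+c : ∀ k a b c → k + a + (b + c) ≡ k + a + b + c
k+a+[b+c]≡k+a+b+c k a b c = sym (+-assoc (k + a) b c)

rotationShapeˡ : ∀ k A B C' → RotationShape k (node (node A B) C') (L ∷ [])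
rotationShapeˡ k A B C' = mkRotationShape k (k + α) (k + α + β) (k + α + β + γ)
  (m<m+leaves k A) (m<m+leaves (k + α) B) (m<m+leaves (k + α + β) C')
  k (k + α + β) (k + α) (k + α + β + γ)
  (inj₁ (refl , refl , refl , refl))
  (whole refl (sym (k+[a+b+c]≡k+a+b+c k α β γ)))
  (inL (inL (whole refl refl)))
  (inL (inR (whole refl refl)))
  (inR (whole (+-assoc k α β) (cong (_+ γ) (+-assoc k α β))))
  (node A B) (goL here) (sym (+-assoc k α β))
  fwd bwd (sym (+-assoc α β γ))
  where
  α = leaves A
  β = leaves B
  γ = leaves C'
  yEq : k + (α + (β + γ)) ≡ k + α + β + γ
  yEq = trans (sym (+-assoc k α (β + γ))) (k+a+[b+c]≡k+a+b+c k α β γ)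
  fwd : ∀ x y → Cluster k (node A (node B C')) x y → Exchanged k (node (node A B) C') k (k + α + β) (k + α) (k + α + β + γ) x y
  fwd x y (whole e1 e2) = inj₁ (whole e1 (trans e2 (cong (k +_) (sym (+-assoc α β γ)))) ,
                           λ { (_ , e) → <-irrefl (trans (sym e) (trans e2 yEq)) (m<m+leaves (k + α + β) C') })
  fwd x y (inL c) = inj₁ (inL (inL c) , ≢⇒¬×≡ʳ (<⇒≢ (≤-<-trans (cluster-end c) (m<m+leaves (k + α) B))))
  fwd x y (inR (whole e1 e2)) = inj₂ (e1 , trans e2 (k+a+[b+c]≡k+a+b+c k α β γ))
  fwd x y (inR (inL c)) = inj₁ (inL (inR c) , ≢⇒¬×≡ˡ (>⇒≢ (<-≤-trans (m<m+leaves k A) (cluster-start c))))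
  fwd x y (inR (inR c)) = inj₁ (inR (cluster-reoffset (+-assoc k α β) c) , ≢⇒¬×≡ˡ (>⇒≢ (<-≤-trans (<-trans (m<m+leaves k A) (m<m+leaves (k + α) B)) (cluster-start c))))
  bwd : ∀ x y → Exchanged k (node (node A B) C') k (k + α + β) (k + α) (k + α + β + γ) x y → Cluster k (node A (node B C')) x y
  bwd x y (inj₂ (e1 , e2)) = inR (whole e1 (trans e2 (sym (k+a+[b+c]≡k+a+b+c k α β γ))))
  bwd x y (inj₁ (whole e1 e2 , ne)) = whole e1 (trans e2 (cong (k +_) (+-assoc α β γ)))
  bwd x y (inj₁ (inL (whole e1 e2) , ne)) = ⊥-elim (ne (e1 , trans e2 (sym (+-assoc k α β))))
  bwd x y (inj₁ (inL (inL c) , ne)) = inL c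
  bwd x y (inj₁ (inL (inR c) , ne)) = inR (inL c)
  bwd x y (inj₁ (inR c , ne)) = inR (inR (cluster-reoffset (sym (+-assoc k α β)) c))

rotationShapeʳ : ∀ k A B C' → RotationShape k (node A (node B C')) (R ∷ [])
rotationShapeʳ k A B C' = mkRotationShape k (k + α) (k + α + β) (k + α + β + γ)
  (m<m+leaves k A) (m<m+leaves (k + α) B) (m<m+leaves (k + α + β) C')
  (k + α) (k + α + β + γ) k (k + α + β)
  (inj₂ (refl , refl , refl , refl))
  (whole refl (sym yEq))
  (inL (whole refl refl))
  (inR (inL (whole refl refl)))
  (inR (inR (whole refl refl)))
  (node B C') (goR here) (k+a+[b+c]≡k+a+b+c k α β γ)
  fwd bwd (+-assoc α β γ)
  where
  α = leaves A
  β = leaves B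
  γ = leaves C'
  yEq : k + (α + (β + γ)) ≡ k + α + β + γ
  yEq = trans (sym (+-assoc k α (β + γ))) (k+a+[b+c]≡k+a+b+c k α β γ)
  lq : k + α + β < k + α + β + γ
  lq = m<m+leaves (k + α + β) C'
  fwd : ∀ x y → Cluster k (node (node A B) C') x y → Exchanged k (node A (node B C')) (k + α) (k + α + β + γ) k (k + α + β) x y
  fwd x y (whole e1 e2) = inj₁ (whole e1 (trans e2 (cong (k +_) (+-assoc α β γ))) , ≢⇒¬×≡ˡ (λ e → <-irrefl (trans (sym e1) e) (m<m+leaves k A)))
  fwd x y (inL (whole e1 e2)) = inj₂ (e1 , trans e2 (sym (+-assoc k α β)))
  fwd x y (inL (inL c)) = inj₁ (inL c , ≢⇒¬×≡ʳ (<⇒≢ (≤-<-trans (cluster-end c) (<-trans (m<m+leaves (k + α) B) lq))))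
  fwd x y (inL (inR c)) = inj₁ (inR (inL c) , ≢⇒¬×≡ʳ (<⇒≢ (≤-<-trans (cluster-end c) lq)))
  fwd x y (inR c) = inj₁ (inR (inR (cluster-reoffset (sym (+-assoc k α β)) c)) , ≢⇒¬×≡ˡ (λ e → <-irrefl (sym e) (<-≤-trans (m<m+leaves (k + α) B) (≤-trans (≤-reflexive (+-assoc k α β)) (cluster-start c)))))
  bwd : ∀ x y → Exchanged k (node A (node B C')) (k + α) (k + α + β + γ) k (k + α + β) x y → Cluster k (node (node A B) C') x y
  bwd x y (inj₂ (e1 , e2)) = inL (whole e1 (trans e2 (+-assoc k α β)))
  bwd x y (inj₁ (whole e1 e2 , _)) = whole e1 (trans e2 (cong (k +_) (sym (+-assoc α β γ))))
  bwd x y (inj₁ (inL c , _)) = inL (inL c)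
  bwd x y (inj₁ (inR (whole e1 e2) , ne)) = ⊥-elim (ne (e1 , trans e2 (k+a+[b+c]≡k+a+b+c k α β γ)))
  bwd x y (inj₁ (inR (inL c) , _)) = inL (inR c)
  bwd x y (inj₁ (inR (inR c) , _)) = inR (cluster-reoffset (+-assoc k α β) c)

liftˡ : ∀ {k l r d p} → RotationShape k l (d ∷ p) → RotationShape k (node l r) (L ∷ d ∷ p)
liftˡ {k} {l} {r} {d} {p} ri = mkRotationShape i j q l' i<j j<q q<l oL oR nL nR shape (inL cluster-il) (inL cluster-ij) (inL cluster-jq) (inL cluster-ql) sub (goL sub-located) sub-end fwd bwd (cong (_+ leaves r) leaves-rotate)
  where
  open RotationShape ri renaming (l to l')
  oRb : oR ≤ k + leaves l
  oRb = ≤-trans (≤-reflexive (sym sub-end)) (proj₂ (located-bounds sub-located))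
  oLR : oL < oR
  oLR = <-≤-trans (m<m+leaves oL sub) (≤-reflexive sub-end)
  fwd : ∀ x y → Cluster k (node (rotate (d ∷ p) l) r) x y → Exchanged k (node l r) oL oR nL nR x y
  fwd x y (whole e1 e2) = inj₁ (whole e1 (trans e2 (cong (λ z → k + (z + leaves r)) leaves-rotate)) ,
    ≢⇒¬×≡ʳ (λ e → <-irrefl (trans (sym e) (trans e2 (cong (λ z → k + (z + leaves r)) leaves-rotate))) (≤-<-trans oRb (+-monoʳ-< k (m<m+n (leaves l) (leaves-positive r))))))
  fwd x y (inL c) with rotate-clusters⇒ x y c
  ... | inj₁ (c' , ne) = inj₁ (inL c' , ne)
  ... | inj₂ e = inj₂ e
  fwd x y (inR c) = inj₁ (inR (cluster-reoffset (cong (k +_) leaves-rotate) c) , ≢⇒¬×≡ˡ (λ e → <-irrefl (sym e) (<-≤-trans oLR (≤-trans oRb (≤-trans (≤-reflexive (cong (k +_) (sym leaves-rotate))) (cluster-start c))))))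
  bwd : ∀ x y → Exchanged k (node l r) oL oR nL nR x y → Cluster k (node (rotate (d ∷ p) l) r) x y
  bwd x y (inj₂ e) = inL (rotate-clusters⇐ x y (inj₂ e))
  bwd x y (inj₁ (whole e1 e2 , ne)) = whole e1 (trans e2 (cong (λ z → k + (z + leaves r)) (sym leaves-rotate)))
  bwd x y (inj₁ (inL c , ne)) = inL (rotate-clusters⇐ x y (inj₁ (c , ne)))
  bwd x y (inj₁ (inR c , ne)) = inR (cluster-reoffset (cong (k +_) (sym leaves-rotate)) c)

liftʳ : ∀ {k l r d p} → RotationShape (k + leaves l) r (d ∷ p) → RotationShape k (node l r) (R ∷ d ∷ p)
liftʳ {k} {l} {r} {d} {p} ri = mkRotationShape i j q l' i<j j<q q<l oL oR nL nR shape (inR cluster-il) (inR cluster-ij) (inR cluster-jq) (inR cluster-ql) sub (goR sub-located) sub-end fwd bwd (cong (leaves l +_) leaves-rotate)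
  where
  open RotationShape ri renaming (l to l')
  oLb : k + leaves l ≤ oL
  oLb = proj₁ (located-bounds sub-located)
  oLR : oL < oR
  oLR = <-≤-trans (m<m+leaves oL sub) (≤-reflexive sub-end)
  fwd : ∀ x y → Cluster k (node l (rotate (d ∷ p) r)) x y → Exchanged k (node l r) oL oR nL nR x y
  fwd x y (whole e1 e2) = inj₁ (whole e1 (trans e2 (cong (λ z → k + (leaves l + z)) leaves-rotate)) ,
    ≢⇒¬×≡ˡ (λ e → <-irrefl (trans (sym e1) e) (<-≤-trans (m<m+leaves k l) oLb)))
  fwd x y (inL c) = inj₁ (inL c , ≢⇒¬×≡ʳ (λ e → <-irrefl e (≤-<-trans (cluster-end c) (≤-<-trans oLb oLR))))
  fwd x y (inR c) with rotate-clusters⇒ x y c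
  ... | inj₁ (c' , ne) = inj₁ (inR c' , ne)
  ... | inj₂ e = inj₂ e
  bwd : ∀ x y → Exchanged k (node l r) oL oR nL nR x y → Cluster k (node l (rotate (d ∷ p) r)) x y
  bwd x y (inj₂ e) = inR (rotate-clusters⇐ x y (inj₂ e))
  bwd x y (inj₁ (whole e1 e2 , ne)) = whole e1 (trans e2 (cong (λ z → k + (leaves l + z)) (sym leaves-rotate)))
  bwd x y (inj₁ (inL c , ne)) = inL c
  bwd x y (inj₁ (inR c , ne)) = inR (rotate-clusters⇐ x y (inj₁ (c , ne)))

rotationShape : ∀ k t w → InternalNonRoot t w → RotationShape k t w
rotationShape k t [] ()
rotationShape k leaf (d ∷ p) (_ , _ , ())
rotationShape k (node (node A B) C') (L ∷ []) _ = rotationShapeˡ k A B C'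
rotationShape k (node leaf r) (L ∷ []) (_ , _ , ())
rotationShape k (node A (node B C')) (R ∷ []) _ = rotationShapeʳ k A B C'
rotationShape k (node l leaf) (R ∷ []) (_ , _ , ())
rotationShape k (node l r) (L ∷ d ∷ p) inr = liftˡ (rotationShape k l (d ∷ p) inr)
rotationShape k (node l r) (R ∷ d ∷ p) inr = liftʳ (rotationShape (k + leaves l) r (d ∷ p) inr)

-- A rotation is a flip

setD-same : ∀ {m} (a b : Fin m) v (S : DSet m) → lookup (lookup (setD a b v S) a) b ≡ v
setD-same a b v S = trans (cong (λ row → lookup row b) (lookup∘updateAt a S)) (lookup∘update b (lookup S a) v)

setD-other : ∀ {m} (a b c d : Fin m) v (S : DSet m) → ¬ (c ≡ a × d ≡ b) →
             lookup (lookup (setD a b v S) c) d ≡ lookup (lookup S c) d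
setD-other a b c d v S ne with c Fin.≟ a
... | no c≢a = cong (λ row → lookup row d) (lookup∘updateAt′ c a c≢a S)
... | yes refl with d Fin.≟ b
...   | yes refl = ⊥-elim (ne (refl , refl))
...   | no d≢b = trans (cong (λ row → lookup row d) (lookup∘updateAt c S)) (lookup∘update′ d≢b (lookup S c) v)

diagonals-exchange : ∀ {n t t' oL oR nL nR} (a b x y : Fin (suc n)) → toℕ a ≡ oL → toℕ b ≡ oR → toℕ x ≡ nL → toℕ y ≡ nR →
                     (∀ c d → Cluster 0 t' c d → Exchanged 0 t oL oR nL nR c d) →
                     (∀ c d → Exchanged 0 t oL oR nL nR c d → Cluster 0 t' c d) →
                     Diagonal (suc n) nL nR → ¬ (oL ≡ nL × oR ≡ nR) →
                     diagonals t' (suc n) ≡ setD x y true (setD a b false (diagonals t (suc n)))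
diagonals-exchange {n} {t} {t'} a b x y refl refl refl refl to from diagonal-new old≢new = dset-ext _ _ entry
  where
  D = diagonals t (suc n)
  entry : ∀ c d → lookup (lookup (diagonals t' (suc n)) c) d ≡ lookup (lookup (setD x y true (setD a b false D)) c) d
  entry c d with (c Fin.≟ x) ×-dec (d Fin.≟ y) | (c Fin.≟ a) ×-dec (d Fin.≟ b)
  ... | yes (refl , refl) | _ = trans (∈diagonals⇐ diagonal-new (from _ _ (inj₂ (refl , refl)))) (sym (setD-same x y true (setD a b false D)))
  ... | no cd≢xy | yes (refl , refl) =
    trans (trans (diagonals-entry t' (suc n) a b) (dec-false (diagonal? (suc n) (toℕ a) (toℕ b) ×-dec cluster? 0 t' (toℕ a) (toℕ b)) old∉t'))
          (sym (trans (setD-other x y a b true (setD a b false D) cd≢xy) (setD-same a b false D)))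
    where
    old∉t' : ¬ (Diagonal (suc n) (toℕ a) (toℕ b) × Cluster 0 t' (toℕ a) (toℕ b))
    old∉t' (_ , c) with to _ _ c
    ... | inj₁ (_ , ne) = ne (refl , refl)
    ... | inj₂ e = old≢new e
  ... | no cd≢xy | no cd≢ab =
    trans (trans (diagonals-entry t' (suc n) c d)
                 (does-⇔ (mk⇔ (λ { (dg , cl) → dg , unchanged cl }) (λ { (dg , cl) → dg , from _ _ (inj₁ (cl , cd≢ab′)) }))
                         (diagonal? (suc n) (toℕ c) (toℕ d) ×-dec cluster? 0 t' (toℕ c) (toℕ d))
                         (diagonal? (suc n) (toℕ c) (toℕ d) ×-dec cluster? 0 t (toℕ c) (toℕ d))))
          (sym (trans (setD-other x y c d true (setD a b false D) cd≢xy) (trans (setD-other a b c d false D cd≢ab) (diagonals-entry t (suc n) c d))))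
    where
    cd≢ab′ : ¬ (toℕ c ≡ toℕ a × toℕ d ≡ toℕ b)
    cd≢ab′ (p , q) = cd≢ab (toℕ-injective p , toℕ-injective q)
    unchanged : Cluster 0 t' (toℕ c) (toℕ d) → Cluster 0 t (toℕ c) (toℕ d)
    unchanged cl with to _ _ cl
    ... | inj₁ (cl' , _) = cl'
    ... | inj₂ (p , q) = ⊥-elim (cd≢xy (toℕ-injective p , toℕ-injective q))

norm-endpoints : ∀ {m} (c d : Fin m) {x y} → x < y → (toℕ c ≡ x × toℕ d ≡ y) ⊎ (toℕ d ≡ x × toℕ c ≡ y) →
                 toℕ (proj₁ (norm c d)) ≡ x × toℕ (proj₂ (norm c d)) ≡ y
norm-endpoints c d x<y (inj₁ (refl , refl)) with toℕ c <ᵇ toℕ d in eq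
... | true = refl , refl
... | false = ⊥-elim (subst T eq (<⇒<ᵇ x<y))
norm-endpoints c d x<y (inj₂ (refl , refl)) with toℕ c <ᵇ toℕ d in eq
... | false = refl , refl
... | true = ⊥-elim (<-asym x<y (<ᵇ⇒< _ _ (subst T (sym eq) tt)))

OuterApex : ℕ → PTree → ℕ → ℕ → ℕ → Set
OuterApex k t a b b' = (b' < a × Cluster k t b' b × Cluster k t b' a) ⊎ (b < b' × Cluster k t b b' × Cluster k t a b')

record Quadrilateral (k : ℕ) (t : PTree) (a b a' b' : ℕ) : Set where
  constructor mkQuadrilateral
  field
    a<a' : a < a'
    a'<b : a' < b
    cluster-aa' : Cluster k t a a'
    cluster-a'b : Cluster k t a' b
    outer : OuterApex k t a b b'

quadrilateral⇒flip : ∀ {n t T' xy x y x' y'} → leaves t ≡ n → (a b a' b' : Fin (suc n)) →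
                     toℕ a ≡ x → toℕ b ≡ y → toℕ a' ≡ x' → toℕ b' ≡ y' → (a , b) ∈D diagonals t (suc n) →
                     Quadrilateral 0 t x y x' y' → xy ≡ norm a' b' → T' ≡ setD (proj₁ xy) (proj₂ xy) true (setD a b false (diagonals t (suc n))) →
                     Flip (diagonals t (suc n)) a b T' xy
quadrilateral⇒flip {t = t} lt a b a' b' refl refl refl refl ab∈t (mkQuadrilateral a<a' a'<b c-aa' c-a'b outer) xy≡ T'≡ =
  ab∈t , a' , b' , (a<a' , a'<b) , side outer ,
  cluster⇒edge lt a a' a<a' c-aa' , cluster⇒edge lt a' b a'<b c-a'b , edge-bb' outer , edge-b'a outer , xy≡ , T'≡
  where
  side : OuterApex 0 t (toℕ a) (toℕ b) (toℕ b') → toℕ b' < toℕ a ⊎ toℕ b < toℕ b'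
  side (inj₁ (b'<a , _)) = inj₁ b'<a
  side (inj₂ (b<b' , _)) = inj₂ b<b'
  edge-bb' : OuterApex 0 t (toℕ a) (toℕ b) (toℕ b') → Edge (diagonals t _) b b'
  edge-bb' (inj₁ (b'<a , c-b'b , _)) = cluster⇒edge′ lt b b' (<-trans b'<a (<-trans a<a' a'<b)) c-b'b
  edge-bb' (inj₂ (b<b' , c-bb' , _)) = cluster⇒edge lt b b' b<b' c-bb'
  edge-b'a : OuterApex 0 t (toℕ a) (toℕ b) (toℕ b') → Edge (diagonals t _) b' a
  edge-b'a (inj₁ (b'<a , _ , c-b'a)) = cluster⇒edge lt b' a b'<a c-b'a
  edge-b'a (inj₂ (b<b' , _ , c-ab')) = cluster⇒edge′ lt b' a (<-trans a<a' (<-trans a'<b b<b')) c-ab'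

flip⇒quadrilateral : ∀ {n t a b T' xy} → leaves t ≡ n → Flip (diagonals t (suc n)) a b T' xy →
                     ∃[ a' ] ∃[ b' ] (Quadrilateral 0 t (toℕ a) (toℕ b) (toℕ a') (toℕ b') × xy ≡ norm a' b'
                                      × T' ≡ setD (proj₁ xy) (proj₂ xy) true (setD a b false (diagonals t (suc n))))
flip⇒quadrilateral {a = a} {b} lt (_ , a' , b' , (a<a' , a'<b) , side , e-aa' , e-a'b , e-bb' , e-b'a , xy≡ , T'≡) =
  a' , b' , mkQuadrilateral a<a' a'<b (edge⇒cluster lt a a' e-aa' a<a') (edge⇒cluster lt a' b e-a'b a'<b) (outer side) , xy≡ , T'≡
  where
  outer : toℕ b' < toℕ a ⊎ toℕ b < toℕ b' → OuterApex 0 _ (toℕ a) (toℕ b) (toℕ b')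
  outer (inj₁ b'<a) = inj₁ (b'<a , edge⇒cluster′ lt b b' e-bb' (<-trans b'<a (<-trans a<a' a'<b)) , edge⇒cluster lt b' a e-b'a b'<a)
  outer (inj₂ b<b') = inj₂ (b<b' , edge⇒cluster lt b b' e-bb' b<b' , edge⇒cluster′ lt b' a e-b'a (<-trans a<a' (<-trans a'<b b<b')))

split-unique : ∀ {k t a b c c'} → Cluster k t a c → Cluster k t c b → Cluster k t a c' → Cluster k t c' b →
               a < c → c < b → a < c' → c' < b → c ≡ c'
split-unique {c = c} {c'} ac cb ac' c'b a<c c<b a<c' c'<b with <-cmp c c'
... | tri< c<c' _ _ = ⊥-elim (clusters-noncrossing ac' cb a<c c<c' c'<b)
... | tri≈ _ c≡c' _ = c≡c'
... | tri> _ _ c'<c = ⊥-elim (clusters-noncrossing ac c'b a<c' c'<c c<b)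

outer-apex-right : ∀ {k t a b l b'} → Cluster k t a l → Cluster k t b l → a < b → b < l → OuterApex k t a b b' → b' ≡ l
outer-apex-right {l = l} {b' = b'} al bl a<b b<l (inj₂ (b<b' , bb' , ab')) with <-cmp b' l
... | tri< b'<l _ _ = ⊥-elim (clusters-noncrossing ab' bl a<b b<b' b'<l)
... | tri≈ _ b'≡l _ = b'≡l
... | tri> _ _ l<b' = ⊥-elim (clusters-noncrossing al bb' a<b b<l l<b')
outer-apex-right al bl a<b b<l (inj₁ (b'<a , b'b , _)) = ⊥-elim (clusters-noncrossing b'b al b'<a a<b b<l)

outer-apex-left : ∀ {k t i a b b'} → Cluster k t i b → Cluster k t i a → i < a → a < b → OuterApex k t a b b' → b' ≡ i
outer-apex-left ib ia i<a a<b (inj₂ (b<b' , _ , ab')) = ⊥-elim (clusters-noncrossing ib ab' i<a a<b b<b')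
outer-apex-left {i = i} {b' = b'} ib ia i<a a<b (inj₁ (b'<a , b'b , b'a)) with <-cmp b' i
... | tri< b'<i _ _ = ⊥-elim (clusters-noncrossing b'a ib b'<i i<a a<b)
... | tri≈ _ b'≡i _ = b'≡i
... | tri> _ _ i<b' = ⊥-elim (clusters-noncrossing ia b'b i<b' b'<a a<b)

NewEnds : ∀ {k t w} → RotationShape k t w → ℕ → ℕ → Set
NewEnds ρ a' b' = (a' ≡ RotationShape.nL ρ × b' ≡ RotationShape.nR ρ) ⊎ (b' ≡ RotationShape.nL ρ × a' ≡ RotationShape.nR ρ)

rotation-quadrilateral : ∀ {k t w} (ρ : RotationShape k t w) →
                         ∃[ a' ] ∃[ b' ] (Quadrilateral k t (RotationShape.oL ρ) (RotationShape.oR ρ) a' b' × NewEnds ρ a' b')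
rotation-quadrilateral (mkRotationShape i j q l i<j j<q q<l _ _ _ _ (inj₁ (refl , refl , refl , refl)) c-il c-ij c-jq c-ql _ _ _ _ _ _) =
  j , l , mkQuadrilateral i<j j<q c-ij c-jq (inj₂ (q<l , c-ql , c-il)) , inj₁ (refl , refl)
rotation-quadrilateral (mkRotationShape i j q l i<j j<q q<l _ _ _ _ (inj₂ (refl , refl , refl , refl)) c-il c-ij c-jq c-ql _ _ _ _ _ _) =
  q , i , mkQuadrilateral j<q q<l c-jq c-ql (inj₁ (i<j , c-il , c-ij)) , inj₂ (refl , refl)

-- The quadrilateral around the cluster [oL, oR) is forced by the clusters of t, so a flip of the
-- corresponding diagonal can only produce the new cluster of the rotation.
quadrilateral-unique : ∀ {k t w a b a' b'} (ρ : RotationShape k t w) → RotationShape.oL ρ ≡ a → RotationShape.oR ρ ≡ b →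
                       Quadrilateral k t a b a' b' → NewEnds ρ a' b'
quadrilateral-unique (mkRotationShape i j q l i<j j<q q<l _ _ _ _ (inj₁ (refl , refl , refl , refl)) c-il c-ij c-jq c-ql _ _ _ _ _ _)
  refl refl (mkQuadrilateral a<a' a'<b c-aa' c-a'b outer) =
  inj₁ (sym (split-unique c-ij c-jq c-aa' c-a'b i<j j<q a<a' a'<b) , outer-apex-right c-il c-ql (<-trans a<a' a'<b) q<l outer)
quadrilateral-unique (mkRotationShape i j q l i<j j<q q<l _ _ _ _ (inj₂ (refl , refl , refl , refl)) c-il c-ij c-jq c-ql _ _ _ _ _ _)
  refl refl (mkQuadrilateral a<a' a'<b c-aa' c-a'b outer) =
  inj₂ (outer-apex-left c-il c-ij i<j (<-trans a<a' a'<b) outer , sym (split-unique c-jq c-ql c-aa' c-a'b j<q q<l a<a' a'<b))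

nonroot-diagonal : ∀ {n t p a s} → leaves t ≡ n → InternalNonRoot t p → Located 0 t p a s → Diagonal (suc n) a (a + leaves s)
nonroot-diagonal {p = d ∷ p} {a} lt (l , r , e) at with just-injective (trans (sym (located⇒subtreeAt at)) e)
... | refl = ≤-trans (≤-reflexive (+-comm 2 a)) (+-monoʳ-≤ a (+-mono-≤ (leaves-positive l) (leaves-positive r))) ,
             λ { (refl , e') → <-irrefl (trans (suc-injective e') (sym lt)) (located-nonroot-leaves< at) }

diagonal⇒vertex : ∀ {n t x y} → leaves t ≡ n → Diagonal (suc n) x y → Cluster 0 t x y →
                  ∃[ p ] ∃[ s ] (InternalNonRoot t p × Located 0 t p x s × x + leaves s ≡ y)
diagonal⇒vertex lt dg c with cluster⇒located c
... | [] , s , at , se with located-root at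
...   | refl , refl = ⊥-elim (proj₂ dg (refl , cong suc (trans (sym se) lt)))
diagonal⇒vertex {x = x} lt dg c | (d ∷ p) , leaf , at , se = ⊥-elim (<-irrefl (trans (+-comm 1 x) se) (proj₁ dg))
diagonal⇒vertex lt dg c | (d ∷ p) , node l r , at , se = d ∷ p , node l r , (l , r , located⇒subtreeAt at) , at , se

module Rotation {n : ℕ} (t : PTree) (lt : leaves t ≡ n) (w : Path) (inr : InternalNonRoot t w) where
  ρ = rotationShape 0 t w inr
  open RotationShape ρ public
  rt = rotate w t
  lrt : leaves rt ≡ n
  lrt = trans leaves-rotate lt
  cluster-old : Cluster 0 t oL oR
  cluster-old = subst (Cluster 0 t oL) sub-end (located⇒cluster sub-located)
  cluster-new : Cluster 0 rt nL nR
  cluster-new = rotate-clusters⇐ nL nR (inj₂ (refl , refl))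
  diagonal-old : Diagonal (suc n) oL oR
  diagonal-old = subst (Diagonal (suc n) oL) sub-end (nonroot-diagonal lt inr sub-located)
  ln : l ≤ n
  ln = ≤-trans (cluster-end cluster-il) (≤-reflexive lt)
  diagonal-new : Diagonal (suc n) nL nR
  diagonal-new with shape
  ... | inj₁ (_ , _ , e1 , e2) = subst₂ (Diagonal (suc n)) (sym e1) (sym e2)
          (≤-trans (s≤s j<q) q<l , λ { (e , _) → <-irrefl (sym e) (≤-<-trans z≤n i<j) })
  ... | inj₂ (_ , _ , e1 , e2) = subst₂ (Diagonal (suc n)) (sym e1) (sym e2)
          (≤-trans (s≤s i<j) j<q , λ { (_ , e) → <-irrefl (suc-injective e) (<-≤-trans q<l ln) })
  old≢new : ¬ (oL ≡ nL × oR ≡ nR)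
  old≢new (f , _) with shape
  ... | inj₁ (e1 , _ , e3 , _) = <-irrefl (trans (sym e1) (trans f e3)) i<j
  ... | inj₂ (e1 , _ , e3 , _) = <-irrefl (sym (trans (sym e1) (trans f e3))) i<j
  nRn : nR ≤ n
  nRn = ≤-trans (cluster-end cluster-new) (≤-reflexive lrt)
  nLn : nL ≤ n
  nLn = ≤-trans (<⇒≤ (cluster-nonempty cluster-new)) nRn
  oRn : oR ≤ n
  oRn = ≤-trans (cluster-end cluster-old) (≤-reflexive lt)
  oLn : oL ≤ n
  oLn = ≤-trans (<⇒≤ (cluster-nonempty cluster-old)) oRn

  new-diagonal : ∀ {B} (x y : Fin (suc n)) → toℕ x ≡ nL → toℕ y ≡ nR → Cluster 0 B nL nR → (x , y) ∈D diagonals B (suc n)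
  new-diagonal x y ex ey = ∈diagonals⇐′ x y ex ey diagonal-new

  diagonals-rotate : ∀ (a b x y : Fin (suc n)) → toℕ a ≡ oL → toℕ b ≡ oR → toℕ x ≡ nL → toℕ y ≡ nR →
                     diagonals rt (suc n) ≡ setD x y true (setD a b false (diagonals t (suc n)))
  diagonals-rotate a b x y ea eb ex ey = diagonals-exchange a b x y ea eb ex ey rotate-clusters⇒ rotate-clusters⇐ diagonal-new old≢new

  rotation-flip : ∀ (a b x y : Fin (suc n)) → toℕ a ≡ oL → toℕ b ≡ oR → toℕ x ≡ nL → toℕ y ≡ nR →
                  Flip (diagonals t (suc n)) a b (diagonals rt (suc n)) (x , y)
  rotation-flip a b x y ea eb ex ey with rotation-quadrilateral ρ
  ... | a' , b' , quad , ends =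
    quadrilateral⇒flip lt a b (vertex a' a'≤n) (vertex b' b'≤n) ea eb (toℕ-vertex a' a'≤n) (toℕ-vertex b' b'≤n)
      (∈diagonals⇐′ a b ea eb diagonal-old cluster-old) quad (sym xy≡) (diagonals-rotate a b x y ea eb ex ey)
    where
    open Quadrilateral quad
    a'≤n : a' ≤ n
    a'≤n = ≤-trans (<⇒≤ a'<b) oRn
    b'≤n : b' ≤ n
    b'≤n with outer
    ... | inj₁ (b'<a , _) = ≤-trans (<⇒≤ (<-≤-trans b'<a (<⇒≤ a<a'))) a'≤n
    ... | inj₂ (_ , _ , c-ab') = ≤-trans (cluster-end c-ab') (≤-reflexive lt)
    ends′ : (toℕ (vertex a' a'≤n) ≡ nL × toℕ (vertex b' b'≤n) ≡ nR) ⊎ (toℕ (vertex b' b'≤n) ≡ nL × toℕ (vertex a' a'≤n) ≡ nR)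
    ends′ = ⊎-map (λ { (p , q) → trans (toℕ-vertex a' a'≤n) p , trans (toℕ-vertex b' b'≤n) q })
                  (λ { (p , q) → trans (toℕ-vertex b' b'≤n) p , trans (toℕ-vertex a' a'≤n) q }) ends
    xy≡ : norm (vertex a' a'≤n) (vertex b' b'≤n) ≡ (x , y)
    xy≡ with norm-endpoints (vertex a' a'≤n) (vertex b' b'≤n) (cluster-nonempty cluster-new) ends′
    ... | p , q = cong₂ _,_ (toℕ-injective (trans p (sym ex))) (toℕ-injective (trans q (sym ey)))

record RotationWitness {n : ℕ} (t : PTree) (a b : Fin (suc n)) (T' : DSet (suc n)) (xy : Fin (suc n) × Fin (suc n)) : Set where
  constructor mkRotationWitness
  field
    w : Path
    inr : InternalNonRoot t w
    ea : toℕ a ≡ RotationShape.oL (rotationShape 0 t w inr)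
    eb : toℕ b ≡ RotationShape.oR (rotationShape 0 t w inr)
    ex : toℕ (proj₁ xy) ≡ RotationShape.nL (rotationShape 0 t w inr)
    ey : toℕ (proj₂ xy) ≡ RotationShape.nR (rotationShape 0 t w inr)
    eT : T' ≡ diagonals (rotate w t) (suc n)

flip⇒rotation : ∀ {n} t → leaves t ≡ n → ∀ a b T' xy → Flip (diagonals t (suc n)) a b T' xy → RotationWitness t a b T' xy
flip⇒rotation {n} t lt a b T' xy fl with ∈diagonals⇒ {t} (proj₁ fl)
... | dg , cl with diagonal⇒vertex lt dg cl
... | w , s , inr , at , se with flip⇒quadrilateral lt fl
... | a' , b' , quad , xy≡ , T'≡ = mkRotationWitness w inr (sym oL≡a) (sym oR≡b) (proj₁ ends) (proj₂ ends)
        (trans T'≡ (sym (diagonals-rotate a b (proj₁ xy) (proj₂ xy) (sym oL≡a) (sym oR≡b) (proj₁ ends) (proj₂ ends))))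
  where
  open Rotation t lt w inr
  oL≡a : oL ≡ toℕ a
  oL≡a = proj₁ (located-unique sub-located at)
  oR≡b : oR ≡ toℕ b
  oR≡b = trans (sym sub-end) (trans (cong₂ (λ u z → u + leaves z) oL≡a (proj₂ (located-unique sub-located at))) se)
  ends : toℕ (proj₁ xy) ≡ nL × toℕ (proj₂ xy) ≡ nR
  ends = subst (λ z → toℕ (proj₁ z) ≡ nL × toℕ (proj₂ z) ≡ nR) (sym xy≡)
           (norm-endpoints a' b' (cluster-nonempty cluster-new) (quadrilateral-unique ρ oL≡a oR≡b quad))

-- Proper subtanglegrams are common diagonals

located⇒properSub : ∀ {A B u v x s s'} → InternalNonRoot A u → InternalNonRoot B v →
                    Located 0 A u x s → Located 0 B v x s' → leaves s ≡ leaves s' → ProperSub A B u v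
located⇒properSub iu iv atA atB e =
  iu , iv , consecutive _ _ , located⇒descLeaves atA , trans (located⇒descLeaves atB) (cong (λ m → just (consecutive _ m)) (sym e))

record CommonDiagonal (n : ℕ) (A B : PTree) (v : Path) : Set where
  constructor mkCommonDiagonal
  field
    x y : ℕ
    diagonal : Diagonal (suc n) x y
    clusterA : Cluster 0 A x y
    clusterB : Cluster 0 B x y
    located-v : ∀ {x' s} → Located 0 B v x' s → x' ≡ x × x' + leaves s ≡ y

properSub⇒commonDiagonal : ∀ {n A B u v} → leaves A ≡ n → ProperSub A B u v → CommonDiagonal n A B v
properSub⇒commonDiagonal {u = []} lA (() , _)
properSub⇒commonDiagonal {u = _ ∷ _} {[]} lA (_ , () , _)
properSub⇒commonDiagonal {A = A} {B} {u@(_ ∷ _)} {v@(_ ∷ _)} lA ((l , r , subA) , (l' , r' , subB) , _ , dA , dB)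
  with subtreeAt⇒located 0 A u subA | subtreeAt⇒located 0 B v subB
... | x , atA | x' , atB = mkCommonDiagonal x (x + leaves (node l r)) (nonroot-diagonal lA (l , r , subA) atA) (located⇒cluster atA) clusterB located-v
  where
  same : x ≡ x' × leaves (node l r) ≡ leaves (node l' r')
  same = consecutive-injective _ _ (leaves-positive (node l r))
           (trans (just-injective (trans (sym (located⇒descLeaves atA)) dA)) (just-injective (trans (sym dB) (located⇒descLeaves atB))))
  end≡ : x' + leaves (node l' r') ≡ x + leaves (node l r)
  end≡ = cong₂ _+_ (sym (proj₁ same)) (sym (proj₂ same))
  clusterB : Cluster 0 B x (x + leaves (node l r))
  clusterB = subst₂ (Cluster 0 B) (sym (proj₁ same)) end≡ (located⇒cluster atB)
  located-v : ∀ {x'' s} → Located 0 B v x'' s → x'' ≡ x × x'' + leaves s ≡ x + leaves (node l r)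
  located-v at with located-unique at atB
  ... | refl , refl = sym (proj₁ same) , end≡

commonDiagonal⇒properSub : ∀ {n A B x y} → leaves A ≡ n → leaves B ≡ n → Diagonal (suc n) x y → Cluster 0 A x y → Cluster 0 B x y →
                           ∃[ u ] ∃[ v ] ProperSub A B u v
commonDiagonal⇒properSub {x = x} lA lB dg cA cB with diagonal⇒vertex lA dg cA | diagonal⇒vertex lB dg cB
... | u , _ , iu , atA , endA | v , _ , iv , atB , endB = u , v , located⇒properSub iu iv atA atB (+-cancelˡ-≡ x _ _ (trans endA (sym endB)))

Disjoint : ℕ → PTree → PTree → Set
Disjoint n A B = ∀ x y → Diagonal (suc n) x y → Cluster 0 A x y → Cluster 0 B x y → ⊥

disjoint-sym : ∀ {n A B} → Disjoint n A B → Disjoint n B A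
disjoint-sym dj x y dg cB cA = dj x y dg cA cB

irreducible⇒disjoint : ∀ {n A B} → leaves A ≡ n → leaves B ≡ n → Irreducible (A , B) → Disjoint n A B
irreducible⇒disjoint lA lB irr x y dg cA cB = irr (commonDiagonal⇒properSub lA lB dg cA cB)

disjoint⇒irreducible : ∀ {n A B} → leaves A ≡ n → Disjoint n A B → Irreducible (A , B)
disjoint⇒irreducible lA dj (_ , _ , ps) with properSub⇒commonDiagonal lA ps
... | mkCommonDiagonal x y dg cA cB _ = dj x y dg cA cB

DiagonalsDisjoint : ∀ {m} → DSet m → DSet m → Set
DiagonalsDisjoint {m} T₁ T₂ = ∀ (a b : Fin m) → ¬ ((a , b) ∈D T₁ × (a , b) ∈D T₂)

disjoint⇒diagonals-disjoint : ∀ {n A B} → Disjoint n A B → DiagonalsDisjoint (diagonals A (suc n)) (diagonals B (suc n))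
disjoint⇒diagonals-disjoint {A = A} {B} dj a b (m₁ , m₂) = dj (toℕ a) (toℕ b) (proj₁ (∈diagonals⇒ {A} m₁)) (proj₂ (∈diagonals⇒ {A} m₁)) (proj₂ (∈diagonals⇒ {B} m₂))

diagonals-disjoint⇒disjoint : ∀ {n A B} → leaves A ≡ n → DiagonalsDisjoint (diagonals A (suc n)) (diagonals B (suc n)) → Disjoint n A B
diagonals-disjoint⇒disjoint {n} lA dj x y dg cA cB =
  dj (vertex x x≤n) (vertex y y≤n) (∈diagonals⇐′ _ _ (toℕ-vertex x x≤n) (toℕ-vertex y y≤n) dg cA , ∈diagonals⇐′ _ _ (toℕ-vertex x x≤n) (toℕ-vertex y y≤n) dg cB)
  where
  y≤n : y ≤ n
  y≤n = ≤-trans (cluster-end cA) (≤-reflexive lA)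
  x≤n : x ≤ n
  x≤n = ≤-trans (<⇒≤ (cluster-nonempty cA)) y≤n

-- Rotating a layout is flipping a pair of triangulations

CompleteRotation : PTree → PTree → PTree → PTree → Set
CompleteRotation P B A' B' =
  (¬ (∃[ w₁ ] ∃[ w₂ ] ProperSub P B w₁ w₂) × (A' , B') ≡ (P , B))
  ⊎ (∃[ w₁ ] ∃[ w₂ ] (ProperSub P B w₁ w₂ × (A' , B') ≡ (P , rotate w₂ B)))

RotationIn₁ : PTree → PTree → PTree → PTree → Set
RotationIn₁ A B A' B' = ∃[ w ] (InternalNonRoot A w × CompleteRotation (rotate w A) B A' B')

CompleteFlip : ∀ {m} → DSet m → Fin m × Fin m → DSet m → DSet m → DSet m → Set
CompleteFlip T₁' xy T₂ T₁″ T₂″ =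
  (xy ∈D T₂ × ∃[ T₂' ] ∃[ uv ] (Flip T₂ (proj₁ xy) (proj₂ xy) T₂' uv × (T₁″ , T₂″) ≡ (T₁' , T₂')))
  ⊎ (¬ (xy ∈D T₂) × (T₁″ , T₂″) ≡ (T₁' , T₂))

FlipIn₁ : ∀ {m} → DSet m → DSet m → DSet m → DSet m → Set
FlipIn₁ T₁ T₂ T₁″ T₂″ = ∃[ a ] ∃[ b ] ∃[ T₁' ] ∃[ xy ] (Flip T₁ a b T₁' xy × CompleteFlip T₁' xy T₂ T₁″ T₂″)

diagonalPair : ∀ n → Pair → DPair (suc n)
diagonalPair n (A , B) = diagonals A (suc n) , diagonals B (suc n)

module _ {n : ℕ} {A B A' B' : PTree} (lA : leaves A ≡ n) (lB : leaves B ≡ n) (lA' : leaves A' ≡ n) (lB' : leaves B' ≡ n)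
         (dj : Disjoint n A B) where

  -- A and B share no diagonal, so a proper subtanglegram created by rotating A sits at the new cluster.
  common-is-new : ∀ {w} (inr : InternalNonRoot A w) {v} → CommonDiagonal n (rotate w A) B v →
                  let open Rotation A lA w inr in
                  Cluster 0 B nL nR × (∀ {x s} → Located 0 B v x s → x ≡ nL × x + leaves s ≡ nR)
  common-is-new {w} inr (mkCommonDiagonal x y dg c-rt c-B located-v) with Rotation.rotate-clusters⇒ A lA w inr x y c-rt
  ... | inj₁ (c-A , _) = ⊥-elim (dj x y dg c-A c-B)
  ... | inj₂ (x≡nL , y≡nR) =
    subst₂ (Cluster 0 B) x≡nL y≡nR c-B , λ at → trans (proj₁ (located-v at)) x≡nL , trans (proj₂ (located-v at)) y≡nR

  rotation⇒flip₁ : RotationIn₁ A B A' B' → FlipIn₁ (diagonals A (suc n)) (diagonals B (suc n)) (diagonals A' (suc n)) (diagonals B' (suc n))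
  rotation⇒flip₁ (w , inr , second) = vertex oL oLn , vertex oR oRn , diagonals rt (suc n) , new ,
    rotation-flip _ _ _ _ (toℕ-vertex oL oLn) (toℕ-vertex oR oRn) (toℕ-vertex nL nLn) (toℕ-vertex nR nRn) , flip₂ second
    where
    open Rotation A lA w inr
    new = vertex nL nLn , vertex nR nRn
    flip₂ : CompleteRotation rt B A' B' → CompleteFlip (diagonals rt (suc n)) new (diagonals B (suc n)) (diagonals A' (suc n)) (diagonals B' (suc n))
    flip₂ (inj₁ (no-sub , eq)) = inj₂ (new∉B , cong (diagonalPair n) eq)
      where
      new∉B : ¬ (new ∈D diagonals B (suc n))
      new∉B m = no-sub (commonDiagonal⇒properSub lrt lB (proj₁ (∈diagonals⇒ {B} m))
                          (subst₂ (Cluster 0 rt) (sym (toℕ-vertex nL nLn)) (sym (toℕ-vertex nR nRn)) cluster-new) (proj₂ (∈diagonals⇒ {B} m)))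
    flip₂ (inj₂ (w₁ , w₂ , ps , eq)) with common-is-new inr (properSub⇒commonDiagonal lrt ps)
    ... | c-B , located-v =
      inj₁ (new-diagonal _ _ (toℕ-vertex nL nLn) (toℕ-vertex nR nRn) c-B , diagonals R₂.rt (suc n) , (vertex R₂.nL R₂.nLn , vertex R₂.nR R₂.nRn) ,
            R₂.rotation-flip _ _ _ _ (trans (toℕ-vertex nL nLn) (sym (proj₁ at-w₂))) (trans (toℕ-vertex nR nRn) (sym (trans (sym R₂.sub-end) (proj₂ at-w₂))))
              (toℕ-vertex R₂.nL R₂.nLn) (toℕ-vertex R₂.nR R₂.nRn) ,
            cong (diagonalPair n) eq)
      where
      module R₂ = Rotation B lB w₂ (proj₁ (proj₂ ps))
      at-w₂ : R₂.oL ≡ nL × R₂.oL + leaves R₂.sub ≡ nR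
      at-w₂ = located-v R₂.sub-located

  flip⇒rotation₁ : FlipIn₁ (diagonals A (suc n)) (diagonals B (suc n)) (diagonals A' (suc n)) (diagonals B' (suc n)) → RotationIn₁ A B A' B'
  flip⇒rotation₁ (a , b , T₁' , xy , fl , second) with flip⇒rotation A lA a b T₁' xy fl
  ... | mkRotationWitness w inr _ _ ex ey eT = w , inr , rotation₂ second
    where
    open Rotation A lA w inr
    A'≡rt : T₁' ≡ diagonals A' (suc n) → A' ≡ rt
    A'≡rt e = diagonals-injective lA' lrt (trans (sym e) eT)
    rotation₂ : CompleteFlip T₁' xy (diagonals B (suc n)) (diagonals A' (suc n)) (diagonals B' (suc n)) → CompleteRotation rt B A' B'
    rotation₂ (inj₂ (xy∉B , eq)) = inj₁ (no-sub , cong₂ _,_ (A'≡rt (sym (cong proj₁ eq))) (diagonals-injective lB' lB (cong proj₂ eq)))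
      where
      no-sub : ¬ (∃[ w₁ ] ∃[ w₂ ] ProperSub rt B w₁ w₂)
      no-sub (_ , _ , ps) = xy∉B (new-diagonal _ _ ex ey (proj₁ (common-is-new inr (properSub⇒commonDiagonal lrt ps))))
    rotation₂ (inj₁ (_ , T₂' , uv , fl₂ , eq)) with flip⇒rotation B lB (proj₁ xy) (proj₂ xy) T₂' uv fl₂ | diagonal⇒vertex lrt diagonal-new cluster-new
    ... | mkRotationWitness w₂ inr₂ ea₂ eb₂ _ _ eT₂ | w₁ , s₁ , inr₁ , at₁ , end₁ =
      inj₂ (w₁ , w₂ , located⇒properSub inr₁ inr₂ at₁ (subst (λ z → Located 0 B w₂ z R₂.sub) oL₂≡nL R₂.sub-located) same-size ,
            cong₂ _,_ (A'≡rt (sym (cong proj₁ eq))) (diagonals-injective lB' R₂.lrt (trans (cong proj₂ eq) eT₂)))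
      where
      module R₂ = Rotation B lB w₂ inr₂
      oL₂≡nL : R₂.oL ≡ nL
      oL₂≡nL = trans (sym ea₂) ex
      same-size : leaves s₁ ≡ leaves R₂.sub
      same-size = +-cancelˡ-≡ nL _ _ (trans end₁ (trans (sym ey) (trans eb₂ (trans (sym R₂.sub-end) (cong (_+ leaves R₂.sub) oL₂≡nL)))))

rotStep⇒rotationIn₁ : ∀ {A B A' B'} → RotStep (A , B) (A' , B') → RotationIn₁ A B A' B' ⊎ RotationIn₁ B A B' A'
rotStep⇒rotationIn₁ (inj₁ r) = inj₁ r
rotStep⇒rotationIn₁ (inj₂ (w , inr , inj₁ (no-sub , e))) = inj₂ (w , inr , inj₁ (no-sub , cong swap e))
rotStep⇒rotationIn₁ (inj₂ (w , inr , inj₂ (w₁ , w₂ , ps , e))) = inj₂ (w , inr , inj₂ (w₁ , w₂ , ps , cong swap e))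

rotationIn₁⇒rotStep : ∀ {A B A' B'} → RotationIn₁ A B A' B' ⊎ RotationIn₁ B A B' A' → RotStep (A , B) (A' , B')
rotationIn₁⇒rotStep (inj₁ r) = inj₁ r
rotationIn₁⇒rotStep (inj₂ (w , inr , inj₁ (no-sub , e))) = inj₂ (w , inr , inj₁ (no-sub , cong swap e))
rotationIn₁⇒rotStep (inj₂ (w , inr , inj₂ (w₁ , w₂ , ps , e))) = inj₂ (w , inr , inj₂ (w₁ , w₂ , ps , cong swap e))

flipStep⇒flipIn₁ : ∀ {m} {T₁ T₂ T₁' T₂' : DSet m} → FlipStep (T₁ , T₂) (T₁' , T₂') → FlipIn₁ T₁ T₂ T₁' T₂' ⊎ FlipIn₁ T₂ T₁ T₂' T₁'
flipStep⇒flipIn₁ (inj₁ f) = inj₁ f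
flipStep⇒flipIn₁ (inj₂ (a , b , T' , xy , fl , inj₁ (m , T″ , uv , fl₂ , e))) = inj₂ (a , b , T' , xy , fl , inj₁ (m , T″ , uv , fl₂ , cong swap e))
flipStep⇒flipIn₁ (inj₂ (a , b , T' , xy , fl , inj₂ (nm , e))) = inj₂ (a , b , T' , xy , fl , inj₂ (nm , cong swap e))

flipIn₁⇒flipStep : ∀ {m} {T₁ T₂ T₁' T₂' : DSet m} → FlipIn₁ T₁ T₂ T₁' T₂' ⊎ FlipIn₁ T₂ T₁ T₂' T₁' → FlipStep (T₁ , T₂) (T₁' , T₂')
flipIn₁⇒flipStep (inj₁ f) = inj₁ f
flipIn₁⇒flipStep (inj₂ (a , b , T' , xy , fl , inj₁ (m , T″ , uv , fl₂ , e))) = inj₂ (a , b , T' , xy , fl , inj₁ (m , T″ , uv , fl₂ , cong swap e))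
flipIn₁⇒flipStep (inj₂ (a , b , T' , xy , fl , inj₂ (nm , e))) = inj₂ (a , b , T' , xy , fl , inj₂ (nm , cong swap e))

toVertex : ∀ {n} → Layout n → DVertex (suc n)
toVertex {n} ((A , B) , lA , lB , irr) =
  diagonalPair n (A , B) , diagonals-triangulation n A lA , diagonals-triangulation n B lB ,
  disjoint⇒diagonals-disjoint (irreducible⇒disjoint lA lB irr)

treePair : ∀ {n} → DPair (suc n) → Pair
treePair (T₁ , T₂) = treeOf T₁ , treeOf T₂

fromVertex : ∀ {n} → 1 ≤ n → DVertex (suc n) → Layout n
fromVertex p ((T₁ , T₂) , tri₁ , tri₂ , dj) =
  treePair (T₁ , T₂) , leaves-treeOf T₁ p , leaves-treeOf T₂ p ,
  disjoint⇒irreducible (leaves-treeOf T₁ p) (diagonals-disjoint⇒disjoint (leaves-treeOf T₁ p)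
    (subst₂ DiagonalsDisjoint (sym (diagonals-treeOf T₁ p tri₁)) (sym (diagonals-treeOf T₂ p tri₂)) dj))

rotStep⇒flipStep : ∀ {n} (x y : Layout n) → RotStep (proj₁ x) (proj₁ y) → FlipStep (proj₁ (toVertex x)) (proj₁ (toVertex y))
rotStep⇒flipStep ((A , B) , lA , lB , irr) (_ , lA' , lB' , _) st = flipIn₁⇒flipStep (⊎-map
  (rotation⇒flip₁ lA lB lA' lB' dj)
  (rotation⇒flip₁ lB lA lB' lA' (disjoint-sym dj)) (rotStep⇒rotationIn₁ st))
  where dj = irreducible⇒disjoint lA lB irr

flipStep⇒rotStep : ∀ {n} (x y : Layout n) → FlipStep (proj₁ (toVertex x)) (proj₁ (toVertex y)) → RotStep (proj₁ x) (proj₁ y)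
flipStep⇒rotStep ((A , B) , lA , lB , irr) (_ , lA' , lB' , _) st = rotationIn₁⇒rotStep (⊎-map
  (flip⇒rotation₁ lA lB lA' lB' dj)
  (flip⇒rotation₁ lB lA lB' lA' (disjoint-sym dj)) (flipStep⇒flipIn₁ st))
  where dj = irreducible⇒disjoint lA lB irr

theorem4p9 : (n : ℕ) → 2 ≤ n →
    GraphIso (_≈L_ {n}) (_≈D_ {suc n}) (LAdj {n}) (DAdj {suc n})
theorem4p9 n 2≤n = record
  { to = toVertex
  ; from = fromVertex 1≤n
  ; to-cong = cong (diagonalPair n)
  ; from-cong = cong treePair
  ; from-to = λ { ((A , B) , lA , lB , _) → cong₂ _,_ (treeOf-diagonals lA 1≤n) (treeOf-diagonals lB 1≤n) }
  ; to-from = λ { ((T₁ , T₂) , tri₁ , tri₂ , _) → cong₂ _,_ (diagonals-treeOf T₁ 1≤n tri₁) (diagonals-treeOf T₂ 1≤n tri₂) }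
  ; adj = λ x y → mk⇔ (⊎-map (rotStep⇒flipStep x y) (rotStep⇒flipStep y x)) (⊎-map (flipStep⇒rotStep x y) (flipStep⇒rotStep y x))
  }
  where
  1≤n : 1 ≤ n
  1≤n = ≤-trans (s≤s z≤n) 2≤n
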